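{- For a root ideal $\Psi\subset\Delta^+_\ell$, a multiset $M$ with support in $[\ell]$, and $\gamma\in\mathbb Z^\ell$, $K(\Psi;M;\gamma)=\kappa\big(\prod_{j\in M}(1-1/z_j)\prod_{(i,j)\in\Delta^+_\ell\setminus\Psi}(1-z_i/z_j)\,\mathbf z^\gamma\big)$, i.e. informally $K(\Psi;M;\gamma)=\prod_{j\in M}(1-L_j)\prod_{(i,j)\in\Delta^+_\ell\setminus\Psi}(1-R_{ij})\,k_\gamma$.
   Context: $h_d$ are the complete homogeneous symmetric functions ($h_0=1$, $h_d=0$ for $d<0$). For $m,r\in\mathbb Z$, $k^{(r)}_m=\sum_{i=0}^m\binom{r+i-1}{i}h_{m-i}$ ($\binom n0=1$, $\binom ni=n(n-1)\cdots(n-i+1)/i!$). For $\gamma\in\mathbb Z^\ell$, $k_\gamma=k^{(0)}_{\gamma_1}k^{(1)}_{\gamma_2}\cdots k^{(\ell-1)}_{\gamma_\ell}$ and $g_\gamma=\det(k^{(i-1)}_{\gamma_i+j-i})_{1\le i,j\le\ell}$. $\Delta^+_\ell=\{(i,j):1\le i<j\le\ell\}$ ordered by $(a,b)\le(c,d)$ iff $a\ge c,b\le d$; a root ideal is an upper order ideal. Let $\mathbb A=\mathbb Z[[z_1/z_2,\dots,z_{\ell-1}/z_\ell]][z_1^{\pm1},\dots,z_\ell^{\pm1}]$ and let $g,\kappa:\mathbb A\to\mathbb Z[h_1,h_2,\dots]$ be the additive maps $\sum c_\gamma\mathbf z^\gamma\mapsto\sum c_\gamma g_\gamma$, resp. $\sum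 c_\gamma k_\gamma$ (the relevant sums are finite). The Katalan function is $K(\Psi;M;\gamma)=g\big(\prod_{(i,j)\in\Psi}(1-z_i/z_j)^{ -1}\prod_{j\in M}(1-1/z_j)\mathbf z^\gamma\big)$, products over $M$ with multiplicity. $R_{ij}$ and $L_j$ denote the operators on indices $\gamma\mapsto\gamma+\epsilon_i-\epsilon_j$ and $\gamma\mapsto\gamma-\epsilon_j$, $\epsilon_i$ the unit vectors. -}

module Defs where

open import Level using (Level)
open import Algebra.Bundles using (CommutativeRing)
open import Data.Bool using (Bool; true; false; if_then_else_)
open import Data.Nat as ℕ using (ℕ; zero; suc; _!)
open import Data.Nat.Properties using (_!≢0)
open import Data.Integer as ℤ using (ℤ; +_; -[1+_]; _/ℕ_)
open import Data.Fin as Fin using (Fin; toℕ; punchIn)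
open import Data.Fin.Properties using (_≟_; _<?_)
open import Data.List using (List; []; _∷_; [_]; _++_; map; concatMap; foldr; replicate; upTo; allFin)
open import Data.Product using (_×_; _,_)
open import Relation.Nullary.Decidable using (⌊_⌋)
open import Relation.Binary.PropositionalEquality using (_≡_)

falling : ℤ → ℕ → ℤ
falling n zero    = + 1
falling n (suc i) = falling n i ℤ.* (n ℤ.- + i)

binom : ℤ → ℕ → ℤ
binom n i = _/ℕ_ (falling n i) (i !) {{i !≢0}}

-- Root ideals of Δ⁺_ℓ = {(i,j) : i < j}  (indices 0-based, Fin ℓ)
-- (a,b) ≤ (c,d) iff a ≥ c and b ≤ d; a root ideal is an upper order ideal.

record RootIdeal (ℓ : ℕ) : Set where
  field
    mem   : Fin ℓ → Fin ℓ → Bool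
    inΔ   : ∀ i j → mem i j ≡ true → i Fin.< j
    upper : ∀ a b c d → mem a b ≡ true → c Fin.≤ a → b Fin.≤ d → mem c d ≡ true

posRoots : (ℓ : ℕ) → List (Fin ℓ × Fin ℓ)
posRoots ℓ = concatMap (λ i → concatMap (λ j → if ⌊ i <? j ⌋ then [ (i , j) ] else []) (allFin ℓ)) (allFin ℓ)

-- Laurent polynomials in z₁..z_ℓ with ℤ coefficients, as formal finite sums
-- of terms  c · z^α

Exp : ℕ → Set
Exp ℓ = Fin ℓ → ℤ

LP : ℕ → Set
LP ℓ = List (ℤ × Exp ℓ)

zeroE : ∀ {ℓ} → Exp ℓ
zeroE _ = + 0

_+E_ : ∀ {ℓ} → Exp ℓ → Exp ℓ → Exp ℓ
(α +E β) k = α k ℤ.+ β k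

_*E_ : ∀ {ℓ} → ℤ → Exp ℓ → Exp ℓ
(a *E α) k = a ℤ.* α k

unitE : ∀ {ℓ} → Fin ℓ → Exp ℓ
unitE i k = if ⌊ k ≟ i ⌋ then + 1 else + 0

rootE : ∀ {ℓ} → Fin ℓ → Fin ℓ → Exp ℓ
rootE i j = unitE i +E ((ℤ.- (+ 1)) *E unitE j)

_⊗_ : ∀ {ℓ} → LP ℓ → LP ℓ → LP ℓ
p ⊗ q = concatMap (λ { (c , α) → map (λ { (d , β) → (c ℤ.* d , α +E β) }) q }) p

oneLP : ∀ {ℓ} → LP ℓ
oneLP = [ (+ 1 , zeroE) ]

prodLP : ∀ {ℓ} → List (LP ℓ) → LP ℓ
prodLP = foldr _⊗_ oneLP

monomial : ∀ {ℓ} → Exp ℓ → LP ℓ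
monomial γ = [ (+ 1 , γ) ]

oneMinusInvZ : ∀ {ℓ} → Fin ℓ → LP ℓ
oneMinusInvZ j = (+ 1 , zeroE) ∷ (ℤ.- (+ 1) , (ℤ.- (+ 1)) *E unitE j) ∷ []

oneMinusR : ∀ {ℓ} → Fin ℓ → Fin ℓ → LP ℓ
oneMinusR i j = (+ 1 , zeroE) ∷ (ℤ.- (+ 1) , rootE i j) ∷ []

-- truncation of (1 - z_i/z_j)^{-1} = Σ_{a ≥ 0} (z_i/z_j)^a  to  a ≤ N
geomTrunc : ∀ {ℓ} → ℕ → Fin ℓ → Fin ℓ → LP ℓ
geomTrunc N i j = map (λ a → (+ 1 , (+ a) *E rootE i j)) (upTo (suc N))

-- ∏_{j ∈ M} (1 - 1/z_j), M given by multiplicities m : Fin ℓ → ℕ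
multisetFactors : ∀ {ℓ} → (Fin ℓ → ℕ) → List (LP ℓ)
multisetFactors {ℓ} m = concatMap (λ j → replicate (m j) (oneMinusInvZ j)) (allFin ℓ)

complementFactors : ∀ {ℓ} → RootIdeal ℓ → List (LP ℓ)
complementFactors {ℓ} Ψ =
  concatMap (λ { (i , j) → if RootIdeal.mem Ψ i j then [] else [ oneMinusR i j ] }) (posRoots ℓ)

idealFactorsTrunc : ∀ {ℓ} → ℕ → RootIdeal ℓ → List (LP ℓ)
idealFactorsTrunc {ℓ} N Ψ =
  concatMap (λ { (i , j) → if RootIdeal.mem Ψ i j then [ geomTrunc N i j ] else [] }) (posRoots ℓ)

-- Symmetric-function side, in an arbitrary commutative ring R with
-- chosen elements h (suc n) = h_{n+1};  h_0 = 1, h_d = 0 for d < 0.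

module _ {a b} (R : CommutativeRing a b) (h : ℕ → CommutativeRing.Carrier R) where
  open CommutativeRing R

  natTimes : ℕ → Carrier → Carrier
  natTimes zero    x = 0#
  natTimes (suc n) x = x + natTimes n x

  scale : ℤ → Carrier → Carrier
  scale (+ n)    x = natTimes n x
  scale -[1+ n ] x = - natTimes (suc n) x

  sumList : List Carrier → Carrier
  sumList = foldr _+_ 0#

  sumFin : ∀ n → (Fin n → Carrier) → Carrier
  sumFin n f = sumList (map f (allFin n))

  prodFin : ∀ n → (Fin n → Carrier) → Carrier
  prodFin n f = foldr _*_ 1# (map f (allFin n))

  hZ : ℤ → Carrier
  hZ (+ zero)  = 1#
  hZ (+ suc n) = h (suc n)
  hZ -[1+ n ]  = 0#

  kr : ℤ → ℤ → Carrier
  kr r (+ m)    = sumList (map (λ i → scale (binom (r ℤ.+ + i ℤ.- + 1) i) (hZ (+ m ℤ.- + i))) (upTo (suc m)))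
  kr r -[1+ m ] = 0#

  sign : ℕ → ℤ
  sign zero    = + 1
  sign (suc n) = ℤ.- sign n

  det : ∀ n → (Fin n → Fin n → Carrier) → Carrier
  det zero    A = 1#
  det (suc n) A = sumFin (suc n) (λ j → scale (sign (toℕ j)) (A Fin.zero j * det n (λ r c → A (Fin.suc r) (punchIn j c))))

  kγ : ∀ ℓ → Exp ℓ → Carrier
  kγ ℓ γ = prodFin ℓ (λ i → kr (+ toℕ i) (γ i))

  -- g_γ = det( k^{(i-1)}_{γ_i + j - i} )  (0-based: k^{(i)}_{γ_i + j - i})
  gγ : ∀ ℓ → Exp ℓ → Carrier
  gγ ℓ γ = det ℓ (λ i j → kr (+ toℕ i) (γ i ℤ.+ + toℕ j ℤ.- + toℕ i))

  κ : ∀ {ℓ} → LP ℓ → Carrier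
  κ {ℓ} p = sumList (map (λ { (c , α) → scale c (kγ ℓ α) }) p)

  gmap : ∀ {ℓ} → LP ℓ → Carrier
  gmap {ℓ} p = sumList (map (λ { (c , α) → scale c (gγ ℓ α) }) p)

  -- K(Ψ;M;γ) with every geometric series (1 - z_i/z_j)^{-1}, (i,j) ∈ Ψ,
  -- truncated at degree N.  K(Ψ;M;γ) is the eventual value as N → ∞.
  KatalanTrunc : ∀ {ℓ} → ℕ → RootIdeal ℓ → (Fin ℓ → ℕ) → Exp ℓ → Carrier
  KatalanTrunc N Ψ m γ =
    gmap (prodLP (idealFactorsTrunc N Ψ ++ multisetFactors m ++ [ monomial γ ]))

  KatalanRHS : ∀ {ℓ} → RootIdeal ℓ → (Fin ℓ → ℕ) → Exp ℓ → Carrier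
  KatalanRHS Ψ m γ =
    κ (prodLP (multisetFactors m ++ complementFactors Ψ ++ [ monomial γ ]))

-- Expanding g_γ = det (k^{(i)}_{γ_i + j - i}) along its rows and comparing with the Vandermonde
-- identity det (z_r^(c - r)) = ∏_{i<j} (1 - z_i/z_j) for Laurent polynomials shows that g = κ ∘ (· ∏_{i<j} (1 - z_i/z_j)).
-- For (i, j) ∈ Ψ the truncated geometric series telescopes against 1 - z_i/z_j to 1 - (z_i/z_j)^(N+1),
-- leaving κ applied to the right-hand side times ∏_{(i,j) ∈ Ψ} (1 - (z_i/z_j)^(N+1)).  Every exponent
-- occurring in the right-hand side has tail sums α_t + ⋯ + α_ℓ bounded by N₀ = Σ_k |γ_k|, so after a
-- shift by (N+1)(ε_i - ε_j) with N ≥ N₀ the tail sum at j is negative; then some coordinate is negative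
-- and k vanishes.  Hence each factor 1 - (z_i/z_j)^(N+1) acts as 1 under κ.
module Submission where

open import Defs
open import Algebra.Bundles using (CommutativeRing)
open import Data.Nat using (ℕ; _≤_)
open import Data.Integer using (ℤ)
open import Data.Fin using (Fin)
open import Data.Product using (∃)

open import Level using (_⊔_; 0ℓ)
open import Algebra.Structures using (IsCommutativeRing)
import Algebra.Properties.Ring as RingProperties
import Algebra.Properties.AbelianGroup as AbelianGroupProperties
import Algebra.Properties.Semiring.Mult as SemiringMultiplication
import Algebra.Properties.CommutativeSemigroup as CommutativeSemigroupProperties
import Algebra.Solver.Ring
import Algebra.Solver.Ring.AlmostCommutativeRing as AlmostCommutativeRing
open import Data.Bool using (Bool; true; false; if_then_else_)
open import Data.Empty using (⊥-elim)
open import Data.Fin as Fin using (toℕ; punchIn; punchOut; inject₁)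
import Data.Fin.Properties as Finₚ
open import Data.Integer as ℤ using (+_; -[1+_]; _⊖_; ∣_∣)
import Data.Integer.Properties as ℤₚ
open import Data.Nat as ℕ using (zero; suc)
import Data.Nat.Properties as ℕₚ
open import Data.List using (List; []; _∷_; [_]; _++_; map; foldr; concatMap; allFin; upTo)
import Data.List.Properties as Listₚ
open import Data.List.Relation.Unary.All as All using (All; []; _∷_)
import Data.List.Relation.Unary.All.Properties as Allₚ
open import Data.List.Relation.Unary.Any as Any using (Any; here; there)
open import Data.Maybe using (Maybe; just; nothing)
open import Data.Product using (Σ; _×_; _,_; proj₂)
open import Data.Sum using (_⊎_; inj₁; inj₂)
open import Data.Unit using (tt)
open import Relation.Nullary using (¬_; Dec; yes; no)
open import Relation.Nullary.Decidable using (⌊_⌋; dec-true; dec-false; isYes≗does)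
import Relation.Binary.PropositionalEquality as ≡
import Relation.Binary.Reasoning.Setoid as SetoidReasoning
open ≡ using (_≡_; _≢_)
open import Function using (_∘_)
open import Data.Vec.Functional using (updateAt)
import Data.Vec.Functional.Properties as Vectorₚ

module IntegerScaling {a b} (R : CommutativeRing a b) (h : ℕ → CommutativeRing.Carrier R) where
  open CommutativeRing R
  open RingProperties ring using (-‿distribˡ-*; -‿distribʳ-*; -‿involutive; -0#≈0#)
  open AbelianGroupProperties +-abelianGroup using (⁻¹-∙-comm; ⁻¹-anti-homo-∙; xyx⁻¹≈y)
  open SemiringMultiplication semiring using (×-congʳ; ×-homo-+; ×-assoc-*; ×1-homo-*) renaming (_×_ to _·_)
  open CommutativeSemigroupProperties *-commutativeSemigroup using (x∙yz≈y∙xz)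
  open SetoidReasoning setoid

  natTimes≡× : ∀ n x → natTimes R h n x ≡ n · x
  natTimes≡× zero    x = ≡.refl
  natTimes≡× (suc n) x = ≡.cong (λ y → x + y) (natTimes≡× n x)

  fromℤ : ℤ → Carrier
  fromℤ z = scale R h z 1#

  fromℕ : ℕ → Carrier
  fromℕ n = natTimes R h n 1#

  fromℕ-homo-+ : ∀ m n → fromℕ (m ℕ.+ n) ≈ fromℕ m + fromℕ n
  fromℕ-homo-+ m n rewrite natTimes≡× (m ℕ.+ n) 1# | natTimes≡× m 1# | natTimes≡× n 1# = ×-homo-+ 1# m n

  fromℕ-homo-* : ∀ m n → fromℕ (m ℕ.* n) ≈ fromℕ m * fromℕ n
  fromℕ-homo-* m n rewrite natTimes≡× (m ℕ.* n) 1# | natTimes≡× m 1# | natTimes≡× n 1# = ×1-homo-* m n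

  natTimes≈fromℕ* : ∀ n x → natTimes R h n x ≈ fromℕ n * x
  natTimes≈fromℕ* n x = begin
    natTimes R h n x ≡⟨ natTimes≡× n x ⟩
    n · x            ≈⟨ ×-congʳ n (sym (*-identityˡ x)) ⟩
    n · (1# * x)     ≈⟨ ×-assoc-* n 1# x ⟨
    n · 1# * x       ≡⟨ ≡.cong (_* x) (natTimes≡× n 1#) ⟨
    fromℕ n * x      ∎

  scale≈fromℤ* : ∀ z x → scale R h z x ≈ fromℤ z * x
  scale≈fromℤ* (+ n)    x = natTimes≈fromℕ* n x
  scale≈fromℤ* -[1+ n ] x = begin
    - natTimes R h (suc n) x    ≈⟨ -‿cong (natTimes≈fromℕ* (suc n) x) ⟩
    - (fromℕ (suc n) * x)       ≈⟨ -‿distribˡ-* _ x ⟩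
    fromℤ -[1+ n ] * x          ∎

  [x+y]-[x+z]≈y-z : ∀ x y z → (x + y) - (x + z) ≈ y - z
  [x+y]-[x+z]≈y-z x y z = begin
    (x + y) + - (x + z)     ≈⟨ +-congˡ (⁻¹-anti-homo-∙ x z) ⟩
    (x + y) + (- z + - x)   ≈⟨ +-assoc (x + y) (- z) (- x) ⟨
    ((x + y) + - z) + - x   ≈⟨ +-congʳ (+-assoc x y (- z)) ⟩
    (x + (y - z)) + - x     ≈⟨ xyx⁻¹≈y x (y - z) ⟩
    y - z                   ∎

  fromℤ-⊖ : ∀ m n → fromℤ (m ⊖ n) ≈ fromℕ m - fromℕ n
  fromℤ-⊖ zero    zero    = sym (trans (+-congˡ -0#≈0#) (+-identityʳ 0#))
  fromℤ-⊖ zero    (suc n) = sym (+-identityˡ _)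
  fromℤ-⊖ (suc m) zero    = sym (trans (+-congˡ -0#≈0#) (+-identityʳ _))
  fromℤ-⊖ (suc m) (suc n) = begin
    fromℤ (suc m ⊖ suc n)          ≡⟨ ≡.cong fromℤ (ℤₚ.[1+m]⊖[1+n]≡m⊖n m n) ⟩
    fromℤ (m ⊖ n)                  ≈⟨ fromℤ-⊖ m n ⟩
    fromℕ m - fromℕ n              ≈⟨ [x+y]-[x+z]≈y-z 1# (fromℕ m) (fromℕ n) ⟨
    fromℕ (suc m) - fromℕ (suc n)  ∎

  fromℤ-homo-+ : ∀ a b → fromℤ (a ℤ.+ b) ≈ fromℤ a + fromℤ b
  fromℤ-homo-+ (+ m)    (+ n)    = fromℕ-homo-+ m n
  fromℤ-homo-+ (+ m)    -[1+ n ] = fromℤ-⊖ m (suc n)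
  fromℤ-homo-+ -[1+ m ] (+ n)    = trans (fromℤ-⊖ n (suc m)) (+-comm _ _)
  fromℤ-homo-+ -[1+ m ] -[1+ n ] = begin
    - fromℕ (suc (suc (m ℕ.+ n)))          ≡⟨ ≡.cong (λ k → - fromℕ (suc k)) (ℕₚ.+-suc m n) ⟨
    - fromℕ (suc m ℕ.+ suc n)              ≈⟨ -‿cong (fromℕ-homo-+ (suc m) (suc n)) ⟩
    - (fromℕ (suc m) + fromℕ (suc n))      ≈⟨ ⁻¹-∙-comm _ _ ⟨
    - fromℕ (suc m) + - fromℕ (suc n)      ∎

  fromℤ-homo-neg : ∀ a → fromℤ (ℤ.- a) ≈ - fromℤ a
  fromℤ-homo-neg (+ zero)  = sym -0#≈0#
  fromℤ-homo-neg (+ suc n) = refl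
  fromℤ-homo-neg -[1+ n ]  = sym (-‿involutive _)

  fromℤ-homo-*-pos : ∀ m b → fromℤ (+ m ℤ.* b) ≈ fromℤ (+ m) * fromℤ b
  fromℤ-homo-*-pos m (+ n)    = begin
    fromℤ (+ m ℤ.* + n)     ≡⟨ ≡.cong fromℤ (ℤₚ.pos-* m n) ⟨
    fromℕ (m ℕ.* n)         ≈⟨ fromℕ-homo-* m n ⟩
    fromℕ m * fromℕ n       ∎
  fromℤ-homo-*-pos m -[1+ n ] = begin
    fromℤ (+ m ℤ.* -[1+ n ])          ≡⟨ ≡.cong fromℤ (ℤₚ.neg-distribʳ-* (+ m) (+ suc n)) ⟨
    fromℤ (ℤ.- (+ m ℤ.* + suc n))     ≈⟨ fromℤ-homo-neg (+ m ℤ.* + suc n) ⟩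
    - fromℤ (+ m ℤ.* + suc n)         ≈⟨ -‿cong (fromℤ-homo-*-pos m (+ suc n)) ⟩
    - (fromℤ (+ m) * fromℤ (+ suc n)) ≈⟨ -‿distribʳ-* _ _ ⟩
    fromℤ (+ m) * fromℤ -[1+ n ]      ∎

  fromℤ-homo-* : ∀ a b → fromℤ (a ℤ.* b) ≈ fromℤ a * fromℤ b
  fromℤ-homo-* (+ m)    b = fromℤ-homo-*-pos m b
  fromℤ-homo-* -[1+ m ] b = begin
    fromℤ (-[1+ m ] ℤ.* b)            ≡⟨ ≡.cong fromℤ (ℤₚ.neg-distribˡ-* (+ suc m) b) ⟨
    fromℤ (ℤ.- (+ suc m ℤ.* b))       ≈⟨ fromℤ-homo-neg (+ suc m ℤ.* b) ⟩
    - fromℤ (+ suc m ℤ.* b)           ≈⟨ -‿cong (fromℤ-homo-*-pos (suc m) b) ⟩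
    - (fromℤ (+ suc m) * fromℤ b)     ≈⟨ -‿distribˡ-* _ _ ⟩
    fromℤ -[1+ m ] * fromℤ b          ∎

  fromℤ-morphism : ℤ.+-*-rawRing AlmostCommutativeRing.-Raw-AlmostCommutative⟶ AlmostCommutativeRing.fromCommutativeRing R
  fromℤ-morphism = record
    { ⟦_⟧    = fromℤ
    ; +-homo = fromℤ-homo-+
    ; *-homo = fromℤ-homo-*
    ; -‿homo = fromℤ-homo-neg
    ; 0-homo = refl
    ; 1-homo = +-identityʳ 1#
    }

  fromℤ-≟ : ∀ a b → Maybe (fromℤ a ≈ fromℤ b)
  fromℤ-≟ a b with a ℤ.≟ b
  ... | yes ≡.refl = just refl
  ... | no _       = nothing

  open Algebra.Solver.Ring ℤ.+-*-rawRing (AlmostCommutativeRing.fromCommutativeRing R) fromℤ-morphism fromℤ-≟ public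
    using (solve; _:=_; _:+_; _:*_; _:-_; :-_)

  scale-congʳ : ∀ z {x y} → x ≈ y → scale R h z x ≈ scale R h z y
  scale-congʳ z {x} {y} x≈y = trans (scale≈fromℤ* z x) (trans (*-congˡ x≈y) (sym (scale≈fromℤ* z y)))

  scale-+ : ∀ z x y → scale R h z (x + y) ≈ scale R h z x + scale R h z y
  scale-+ z x y = trans (scale≈fromℤ* z _) (trans (distribˡ _ x y) (sym (+-cong (scale≈fromℤ* z x) (scale≈fromℤ* z y))))

  scale-*-comm : ∀ z x y → scale R h z (x * y) ≈ x * scale R h z y
  scale-*-comm z x y = begin
    scale R h z (x * y)   ≈⟨ scale≈fromℤ* z _ ⟩
    fromℤ z * (x * y)     ≈⟨ x∙yz≈y∙xz (fromℤ z) x y ⟩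
    x * (fromℤ z * y)     ≈⟨ *-congˡ (scale≈fromℤ* z y) ⟨
    x * scale R h z y     ∎

  scale-0# : ∀ z → scale R h z 0# ≈ 0#
  scale-0# z = trans (scale≈fromℤ* z 0#) (zeroʳ _)

  scale-negˡ : ∀ z x → scale R h (ℤ.- z) x ≈ - scale R h z x
  scale-negˡ z x = begin
    scale R h (ℤ.- z) x    ≈⟨ scale≈fromℤ* (ℤ.- z) x ⟩
    fromℤ (ℤ.- z) * x      ≈⟨ *-congʳ (fromℤ-homo-neg z) ⟩
    - fromℤ z * x          ≈⟨ -‿distribˡ-* _ _ ⟨
    - (fromℤ z * x)        ≈⟨ -‿cong (scale≈fromℤ* z x) ⟨
    - scale R h z x        ∎

  scale-homo-* : ∀ a b x → scale R h (a ℤ.* b) x ≈ scale R h a (scale R h b x)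
  scale-homo-* a b x = begin
    scale R h (a ℤ.* b) x        ≈⟨ scale≈fromℤ* (a ℤ.* b) x ⟩
    fromℤ (a ℤ.* b) * x          ≈⟨ *-congʳ (fromℤ-homo-* a b) ⟩
    (fromℤ a * fromℤ b) * x      ≈⟨ *-assoc _ _ _ ⟩
    fromℤ a * (fromℤ b * x)      ≈⟨ *-congˡ (scale≈fromℤ* b x) ⟨
    fromℤ a * scale R h b x      ≈⟨ scale≈fromℤ* a _ ⟨
    scale R h a (scale R h b x)  ∎

  scale-1 : ∀ x → scale R h (+ 1) x ≈ x
  scale-1 = +-identityʳ

  scale--1 : ∀ x → scale R h (ℤ.- (+ 1)) x ≈ - x
  scale--1 x = -‿cong (+-identityʳ x)

module BigOperators {a b} (R : CommutativeRing a b) (h : ℕ → CommutativeRing.Carrier R) where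
  open CommutativeRing R
  open CommutativeSemigroupProperties +-commutativeSemigroup using () renaming (interchange to +-interchange)
  open CommutativeSemigroupProperties *-commutativeSemigroup using () renaming (interchange to *-interchange)

  ∑ : ∀ {A : Set} → List A → (A → Carrier) → Carrier
  ∑ xs f = sumList R h (map f xs)

  ∏ : ∀ {A : Set} → List A → (A → Carrier) → Carrier
  ∏ xs f = foldr _*_ 1# (map f xs)

  module _ {A : Set} where

    ∑-cong : ∀ (xs : List A) {f g} → (∀ x → f x ≈ g x) → ∑ xs f ≈ ∑ xs g
    ∑-cong []       f≈g = refl
    ∑-cong (x ∷ xs) f≈g = +-cong (f≈g x) (∑-cong xs f≈g)

    ∏-cong : ∀ (xs : List A) {f g} → (∀ x → f x ≈ g x) → ∏ xs f ≈ ∏ xs g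
    ∏-cong []       f≈g = refl
    ∏-cong (x ∷ xs) f≈g = *-cong (f≈g x) (∏-cong xs f≈g)

    ∑-distrib-+ : ∀ (xs : List A) f g → ∑ xs (λ x → f x + g x) ≈ ∑ xs f + ∑ xs g
    ∑-distrib-+ []       f g = sym (+-identityʳ 0#)
    ∑-distrib-+ (x ∷ xs) f g = trans (+-congˡ (∑-distrib-+ xs f g)) (+-interchange _ _ _ _)

    ∏-distrib-* : ∀ (xs : List A) f g → ∏ xs (λ x → f x * g x) ≈ ∏ xs f * ∏ xs g
    ∏-distrib-* []       f g = sym (*-identityʳ 1#)
    ∏-distrib-* (x ∷ xs) f g = trans (*-congˡ (∏-distrib-* xs f g)) (*-interchange _ _ _ _)

    ∑-*ˡ : ∀ (xs : List A) t f → ∑ xs (λ x → t * f x) ≈ t * ∑ xs f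
    ∑-*ˡ []       t f = sym (zeroʳ t)
    ∑-*ˡ (x ∷ xs) t f = trans (+-congˡ (∑-*ˡ xs t f)) (sym (distribˡ t _ _))

    ∑-zero : ∀ (xs : List A) f → (∀ x → f x ≈ 0#) → ∑ xs f ≈ 0#
    ∑-zero []       f f≈0 = refl
    ∑-zero (x ∷ xs) f f≈0 = trans (+-cong (f≈0 x) (∑-zero xs f f≈0)) (+-identityʳ 0#)

    ∏-zero : ∀ (xs : List A) f → Any (λ x → f x ≈ 0#) xs → ∏ xs f ≈ 0#
    ∏-zero (x ∷ xs) f (here fx≈0)  = trans (*-congʳ fx≈0) (zeroˡ _)
    ∏-zero (x ∷ xs) f (there any0) = trans (*-congˡ (∏-zero xs f any0)) (zeroʳ _)

    ∏-++ : ∀ (xs ys : List A) f → ∏ (xs ++ ys) f ≈ ∏ xs f * ∏ ys f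
    ∏-++ []       ys f = sym (*-identityˡ _)
    ∏-++ (x ∷ xs) ys f = trans (*-congˡ (∏-++ xs ys f)) (sym (*-assoc _ _ _))

  ∏-concatMap : ∀ {A B : Set} (xs : List A) (g : A → List B) f → ∏ (concatMap g xs) f ≈ ∏ xs (λ x → ∏ (g x) f)
  ∏-concatMap []       g f = refl
  ∏-concatMap (x ∷ xs) g f = trans (∏-++ (g x) (concatMap g xs) f) (*-congˡ (∏-concatMap xs g f))

  product : List Carrier → Carrier
  product = foldr _*_ 1#

  product-++ : ∀ xs ys → product (xs ++ ys) ≈ product xs * product ys
  product-++ []       ys = sym (*-identityˡ _)
  product-++ (x ∷ xs) ys = trans (*-congˡ (product-++ xs ys)) (sym (*-assoc _ _ _))

  product-concatMap : ∀ {A : Set} (xs : List A) (g : A → List Carrier) → product (concatMap g xs) ≈ ∏ xs (λ x → product (g x))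
  product-concatMap []       g = refl
  product-concatMap (x ∷ xs) g = trans (product-++ (g x) (concatMap g xs)) (*-congˡ (product-concatMap xs g))

  map-allFin-suc : ∀ {c} {A : Set c} n (f : Fin (suc n) → A) → map f (allFin (suc n)) ≡ f Fin.zero ∷ map (λ j → f (Fin.suc j)) (allFin n)
  map-allFin-suc n f = ≡.cong (f Fin.zero ∷_)
    (≡.trans (Listₚ.map-tabulate Fin.suc f) (≡.sym (Listₚ.map-tabulate (λ j → j) (λ j → f (Fin.suc j)))))

  sumFin-suc : ∀ n f → sumFin R h (suc n) f ≡ f Fin.zero + sumFin R h n (λ j → f (Fin.suc j))
  sumFin-suc n f = ≡.cong (foldr _+_ 0#) (map-allFin-suc n f)

  prodFin-suc : ∀ n f → prodFin R h (suc n) f ≡ f Fin.zero * prodFin R h n (λ j → f (Fin.suc j))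
  prodFin-suc n f = ≡.cong (foldr _*_ 1#) (map-allFin-suc n f)

  sumFin-single : ∀ n f (a : Fin n) → (∀ j → j ≢ a → f j ≈ 0#) → sumFin R h n f ≈ f a
  sumFin-single (suc n) f Fin.zero others rewrite sumFin-suc n f =
    trans (+-congˡ (∑-zero (allFin n) _ (λ j → others (Fin.suc j) (λ ())))) (+-identityʳ _)
  sumFin-single (suc n) f (Fin.suc a) others rewrite sumFin-suc n f =
    trans (+-cong (others Fin.zero (λ ())) (sumFin-single n _ a (λ j j≢a → others (Fin.suc j) (j≢a ∘ Finₚ.suc-injective))))
      (+-identityˡ _)

  sumFin-pair : ∀ n f (a b : Fin n) → a ≢ b → (∀ j → j ≢ a → j ≢ b → f j ≈ 0#) → sumFin R h n f ≈ f a + f b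
  sumFin-pair (suc n) f Fin.zero    Fin.zero    a≢b others = ⊥-elim (a≢b ≡.refl)
  sumFin-pair (suc n) f Fin.zero    (Fin.suc b) a≢b others rewrite sumFin-suc n f =
    +-congˡ (sumFin-single n _ b (λ j j≢b → others (Fin.suc j) (λ ()) (j≢b ∘ Finₚ.suc-injective)))
  sumFin-pair (suc n) f (Fin.suc a) Fin.zero    a≢b others rewrite sumFin-suc n f =
    trans (+-congˡ (sumFin-single n _ a (λ j j≢a → others (Fin.suc j) (j≢a ∘ Finₚ.suc-injective) (λ ())))) (+-comm _ _)
  sumFin-pair (suc n) f (Fin.suc a) (Fin.suc b) a≢b others rewrite sumFin-suc n f =
    trans (+-cong (others Fin.zero (λ ()) (λ ()))
                  (sumFin-pair n _ a b (a≢b ∘ ≡.cong Fin.suc)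
                    (λ j j≢a j≢b → others (Fin.suc j) (j≢a ∘ Finₚ.suc-injective) (j≢b ∘ Finₚ.suc-injective))))
      (+-identityˡ _)

toℕ-punchIn-< : ∀ {n} (i : Fin (suc n)) (j : Fin n) → toℕ j ℕ.< toℕ i → toℕ (punchIn i j) ≡ toℕ j
toℕ-punchIn-< (Fin.suc i) Fin.zero    _         = ≡.refl
toℕ-punchIn-< (Fin.suc i) (Fin.suc j) (ℕ.s≤s p) = ≡.cong suc (toℕ-punchIn-< i j p)

toℕ-punchIn-≥ : ∀ {n} (i : Fin (suc n)) (j : Fin n) → toℕ i ℕ.≤ toℕ j → toℕ (punchIn i j) ≡ suc (toℕ j)
toℕ-punchIn-≥ Fin.zero    j           _         = ≡.refl
toℕ-punchIn-≥ (Fin.suc i) (Fin.suc j) (ℕ.s≤s p) = ≡.cong suc (toℕ-punchIn-≥ i j p)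

punchIn-reflects-adjacent : ∀ {n} (j : Fin (suc n)) (a b : Fin n) →
  toℕ (punchIn j b) ≡ suc (toℕ (punchIn j a)) → toℕ b ≡ suc (toℕ a)
punchIn-reflects-adjacent j a b adj with toℕ a ℕ.<? toℕ j | toℕ b ℕ.<? toℕ j
... | yes a<j | yes b<j rewrite toℕ-punchIn-< j a a<j | toℕ-punchIn-< j b b<j = adj
... | yes a<j | no  b≮j rewrite toℕ-punchIn-< j a a<j | toℕ-punchIn-≥ j b (ℕₚ.≮⇒≥ b≮j) =
  ⊥-elim (ℕₚ.<⇒≱ a<j (≡.subst (toℕ j ℕ.≤_) (ℕₚ.suc-injective adj) (ℕₚ.≮⇒≥ b≮j)))
... | no  a≮j | yes b<j rewrite toℕ-punchIn-≥ j a (ℕₚ.≮⇒≥ a≮j) | toℕ-punchIn-< j b b<j =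
  ⊥-elim (ℕₚ.<⇒≱ b<j (ℕₚ.≤-trans (ℕₚ.≮⇒≥ a≮j) (≡.subst (toℕ a ℕ.≤_) (≡.sym adj) (ℕₚ.m≤n+m (toℕ a) 2))))
... | no  a≮j | no  b≮j rewrite toℕ-punchIn-≥ j a (ℕₚ.≮⇒≥ a≮j) | toℕ-punchIn-≥ j b (ℕₚ.≮⇒≥ b≮j) = ℕₚ.suc-injective adj

-- The minors deleting column a or column a + 1 differ only where each keeps the other's deleted column.
punchIn-adjacent : ∀ {n} (a b : Fin (suc n)) → toℕ b ≡ suc (toℕ a) → ∀ c →
  punchIn a c ≡ punchIn b c ⊎ (punchIn a c ≡ b × punchIn b c ≡ a)
punchIn-adjacent a b adj c with toℕ c ℕ.<? toℕ a
... | yes c<a = inj₁ (Finₚ.toℕ-injective (≡.trans (toℕ-punchIn-< a c c<a)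
        (≡.sym (toℕ-punchIn-< b c (≡.subst (toℕ c ℕ.<_) (≡.sym adj) (ℕₚ.m<n⇒m<1+n c<a))))))
... | no  c≮a with toℕ c ℕ.<? toℕ b
...   | yes c<b = inj₂ (Finₚ.toℕ-injective (≡.trans (toℕ-punchIn-≥ a c (ℕₚ.≮⇒≥ c≮a)) (≡.trans (≡.cong suc c≡a) (≡.sym adj))) ,
                        Finₚ.toℕ-injective (≡.trans (toℕ-punchIn-< b c c<b) c≡a))
  where
  c≡a : toℕ c ≡ toℕ a
  c≡a = ℕₚ.≤-antisym (ℕₚ.≤-pred (≡.subst (suc (toℕ c) ℕ.≤_) adj c<b)) (ℕₚ.≮⇒≥ c≮a)
...   | no  c≮b = inj₁ (Finₚ.toℕ-injective (≡.trans (toℕ-punchIn-≥ a c (ℕₚ.≮⇒≥ c≮a)) (≡.sym (toℕ-punchIn-≥ b c (ℕₚ.≮⇒≥ c≮b)))))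

⌊⌋-yes : ∀ {p} {P : Set p} (P? : Dec P) → P → ⌊ P? ⌋ ≡ true
⌊⌋-yes P? p = ≡.trans (isYes≗does P?) (dec-true P? p)

⌊⌋-no : ∀ {p} {P : Set p} (P? : Dec P) → ¬ P → ⌊ P? ⌋ ≡ false
⌊⌋-no P? ¬p = ≡.trans (isYes≗does P?) (dec-false P? ¬p)

⌊≤?⌋-suc : ∀ k m → m ≢ k → ⌊ k ℕ.≤? m ⌋ ≡ ⌊ suc k ℕ.≤? m ⌋
⌊≤?⌋-suc k m m≢k with k ℕ.≤? m
... | yes k≤m = ≡.sym (⌊⌋-yes (suc k ℕ.≤? m) (ℕₚ.≤∧≢⇒< k≤m (m≢k ∘ ≡.sym)))
... | no  k≰m = ≡.sym (⌊⌋-no (suc k ℕ.≤? m) (k≰m ∘ ℕₚ.<⇒≤))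

⌊<?⌋-suc : ∀ {n} (i j : Fin n) → ⌊ Fin.suc i Finₚ.<? Fin.suc j ⌋ ≡ ⌊ i Finₚ.<? j ⌋
⌊<?⌋-suc i j with i Finₚ.<? j
... | yes i<j = ⌊⌋-yes (Fin.suc i Finₚ.<? Fin.suc j) (ℕ.s≤s i<j)
... | no  i≮j = ⌊⌋-no (Fin.suc i Finₚ.<? Fin.suc j) (i≮j ∘ ℕₚ.≤-pred)

module Determinant {a b} (R : CommutativeRing a b) (h : ℕ → CommutativeRing.Carrier R) where
  open CommutativeRing R
  open IntegerScaling R h
  open BigOperators R h
  open CommutativeSemigroupProperties *-commutativeSemigroup using () renaming (interchange to *-interchange)
  open SetoidReasoning setoid

  Matrix : ℕ → Set a
  Matrix n = Fin n → Fin n → Carrier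

  minor : ∀ {n} → Matrix (suc n) → Fin (suc n) → Matrix n
  minor A j r c = A (Fin.suc r) (punchIn j c)

  cofactorTerm : ∀ {n} → Matrix (suc n) → Fin (suc n) → Carrier
  cofactorTerm {n} A j = scale R h (sign R h (toℕ j)) (A Fin.zero j * det R h n (minor A j))

  det-cong : ∀ n {A B : Matrix n} → (∀ r c → A r c ≈ B r c) → det R h n A ≈ det R h n B
  det-cong zero    A≈B = refl
  det-cong (suc n) A≈B = ∑-cong (allFin (suc n)) λ j →
    scale-congʳ (sign R h (toℕ j)) (*-cong (A≈B Fin.zero j) (det-cong n (λ r c → A≈B (Fin.suc r) (punchIn j c))))

  det-linear-column : ∀ n (q : Fin n) (A B C : Matrix n) t →
    (∀ r c → c ≢ q → C r c ≈ A r c) → (∀ r c → c ≢ q → C r c ≈ B r c) →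
    (∀ r → C r q ≈ A r q + t * B r q) → det R h n C ≈ det R h n A + t * det R h n B
  det-linear-column (suc n) q A B C t C≈A C≈B Cq =
    trans (∑-cong (allFin (suc n)) term-linear) (trans (∑-distrib-+ (allFin (suc n)) _ _) (+-congˡ (∑-*ˡ (allFin (suc n)) t _)))
    where
    scale-linear : ∀ s x y → scale R h s (x + t * y) ≈ scale R h s x + t * scale R h s y
    scale-linear s x y = trans (scale-+ s x _) (+-congˡ (scale-*-comm s t y))
    term-linear : ∀ j → cofactorTerm C j ≈ cofactorTerm A j + t * cofactorTerm B j
    term-linear j with j Finₚ.≟ q
    ... | yes ≡.refl = trans (scale-congʳ s (begin
          C Fin.zero j * det R h n (minor C j)
            ≈⟨ *-congʳ (Cq Fin.zero) ⟩
          (A Fin.zero j + t * B Fin.zero j) * det R h n (minor C j)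
            ≈⟨ distribʳ _ _ _ ⟩
          A Fin.zero j * det R h n (minor C j) + (t * B Fin.zero j) * det R h n (minor C j)
            ≈⟨ +-cong (*-congˡ (minor≈ C≈A)) (trans (*-assoc _ _ _) (*-congˡ (*-congˡ (minor≈ C≈B)))) ⟩
          A Fin.zero j * det R h n (minor A j) + t * (B Fin.zero j * det R h n (minor B j)) ∎))
          (scale-linear s _ _)
      where
      s = sign R h (toℕ j)
      minor≈ : ∀ {D} → (∀ r c → c ≢ q → C r c ≈ D r c) → det R h n (minor C j) ≈ det R h n (minor D j)
      minor≈ C≈D = det-cong n (λ r c → C≈D (Fin.suc r) (punchIn j c) (Finₚ.punchInᵢ≢i j c))
    ... | no j≢q = trans (scale-congʳ s (begin
          C Fin.zero j * det R h n (minor C j)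
            ≈⟨ *-congˡ minor-linear ⟩
          C Fin.zero j * (det R h n (minor A j) + t * det R h n (minor B j))
            ≈⟨ solve 4 (λ x u v w → x :* (u :+ w :* v) := x :* u :+ w :* (x :* v)) refl _ _ _ t ⟩
          C Fin.zero j * det R h n (minor A j) + t * (C Fin.zero j * det R h n (minor B j))
            ≈⟨ +-cong (*-congʳ (C≈A Fin.zero j j≢q)) (*-congˡ (*-congʳ (C≈B Fin.zero j j≢q))) ⟩
          A Fin.zero j * det R h n (minor A j) + t * (B Fin.zero j * det R h n (minor B j)) ∎))
          (scale-linear s _ _)
      where
      s = sign R h (toℕ j)
      q′ = punchOut j≢q
      ↑q′≡q : punchIn j q′ ≡ q
      ↑q′≡q = Finₚ.punchIn-punchOut j≢q
      avoids-q : ∀ c → c ≢ q′ → punchIn j c ≢ q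
      avoids-q c c≢q′ ↑c≡q = c≢q′ (Finₚ.punchIn-injective j c q′ (≡.trans ↑c≡q (≡.sym ↑q′≡q)))
      minor-linear = det-linear-column n q′ (minor A j) (minor B j) (minor C j) t
        (λ r c c≢q′ → C≈A (Fin.suc r) (punchIn j c) (avoids-q c c≢q′))
        (λ r c c≢q′ → C≈B (Fin.suc r) (punchIn j c) (avoids-q c c≢q′))
        (λ r → ≡.subst (λ k → C (Fin.suc r) k ≈ A (Fin.suc r) k + t * B (Fin.suc r) k) (≡.sym ↑q′≡q) (Cq (Fin.suc r)))

  minor-adjacent-equal-columns : ∀ {n} (A : Matrix (suc n)) (a b : Fin (suc n)) → toℕ b ≡ suc (toℕ a) →
    (∀ r → A r a ≈ A r b) → ∀ r c → minor A a r c ≈ minor A b r c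
  minor-adjacent-equal-columns A a b adj Aa≈Ab r c with punchIn-adjacent a b adj c
  ... | inj₁ same = reflexive (≡.cong (A (Fin.suc r)) same)
  ... | inj₂ (↑a≡b , ↑b≡a) =
    ≡.subst₂ (λ u v → A (Fin.suc r) u ≈ A (Fin.suc r) v) (≡.sym ↑a≡b) (≡.sym ↑b≡a) (sym (Aa≈Ab (Fin.suc r)))

  det-adjacent-equal-columns : ∀ n (A : Matrix n) (a b : Fin n) → toℕ b ≡ suc (toℕ a) →
    (∀ r → A r a ≈ A r b) → det R h n A ≈ 0#
  det-adjacent-equal-columns (suc n) A a b adj Aa≈Ab =
    trans (sumFin-pair (suc n) (cofactorTerm A) a b a≢b other-terms-vanish) cancelling-pair
    where
    a≢b : a ≢ b
    a≢b a≡b = ℕₚ.1+n≢n (≡.sym (≡.trans (≡.cong toℕ a≡b) adj))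
    other-terms-vanish : ∀ j → j ≢ a → j ≢ b → cofactorTerm A j ≈ 0#
    other-terms-vanish j j≢a j≢b =
      trans (scale-congʳ (sign R h (toℕ j)) (trans (*-congˡ minor-vanishes) (zeroʳ _))) (scale-0# (sign R h (toℕ j)))
      where
      ↑a′≡a : punchIn j (punchOut j≢a) ≡ a
      ↑a′≡a = Finₚ.punchIn-punchOut j≢a
      ↑b′≡b : punchIn j (punchOut j≢b) ≡ b
      ↑b′≡b = Finₚ.punchIn-punchOut j≢b
      minor-vanishes = det-adjacent-equal-columns n (minor A j) (punchOut j≢a) (punchOut j≢b)
        (punchIn-reflects-adjacent j _ _ (≡.trans (≡.cong toℕ ↑b′≡b) (≡.trans adj (≡.cong (suc ∘ toℕ) (≡.sym ↑a′≡a)))))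
        (λ r → ≡.subst₂ (λ u v → A (Fin.suc r) u ≈ A (Fin.suc r) v) (≡.sym ↑a′≡a) (≡.sym ↑b′≡b) (Aa≈Ab (Fin.suc r)))
    -- the two surviving terms have opposite signs and equal entries and minors
    cancelling-pair : cofactorTerm A a + cofactorTerm A b ≈ 0#
    cancelling-pair rewrite adj = begin
      scale R h s (A Fin.zero a * det R h n (minor A a)) + scale R h (ℤ.- s) (A Fin.zero b * det R h n (minor A b))
        ≈⟨ +-congˡ (trans (scale-negˡ s _) (-‿cong (scale-congʳ s (*-cong (sym (Aa≈Ab Fin.zero))
             (sym (det-cong n (minor-adjacent-equal-columns A a b adj Aa≈Ab))))))) ⟩
      scale R h s (A Fin.zero a * det R h n (minor A a)) - scale R h s (A Fin.zero a * det R h n (minor A a))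
        ≈⟨ -‿inverseʳ _ ⟩
      0# ∎
      where s = sign R h (toℕ a)

  det-add-left-column-multiple : ∀ n (A C : Matrix (suc n)) (q : Fin n) t →
    (∀ r c → c ≢ Fin.suc q → C r c ≈ A r c) →
    (∀ r → C r (Fin.suc q) ≈ A r (Fin.suc q) + t * A r (inject₁ q)) →
    det R h (suc n) C ≈ det R h (suc n) A
  det-add-left-column-multiple n A C q t C≈A Cq = begin
    det R h (suc n) C                          ≈⟨ det-linear-column (suc n) (Fin.suc q) A B C t C≈A C≈B Cq′ ⟩
    det R h (suc n) A + t * det R h (suc n) B  ≈⟨ +-congˡ (trans (*-congˡ B-vanishes) (zeroʳ t)) ⟩
    det R h (suc n) A + 0#                     ≈⟨ +-identityʳ _ ⟩
    det R h (suc n) A                          ∎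
    where
    B : Matrix (suc n)
    B r = updateAt (A r) (Fin.suc q) (λ _ → A r (inject₁ q))
    C≈B : ∀ r c → c ≢ Fin.suc q → C r c ≈ B r c
    C≈B r c c≢q = trans (C≈A r c c≢q) (reflexive (≡.sym (Vectorₚ.updateAt-minimal c (Fin.suc q) (A r) c≢q)))
    Cq′ : ∀ r → C r (Fin.suc q) ≈ A r (Fin.suc q) + t * B r (Fin.suc q)
    Cq′ r = trans (Cq r) (reflexive (≡.cong (λ x → A r (Fin.suc q) + t * x) (≡.sym (Vectorₚ.updateAt-updates (Fin.suc q) (A r)))))
    inject₁q≢sucq : inject₁ q ≢ Fin.suc q
    inject₁q≢sucq eq = ℕₚ.1+n≢n (≡.sym (≡.trans (≡.sym (Finₚ.toℕ-inject₁ q)) (≡.cong toℕ eq)))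
    B-vanishes : det R h (suc n) B ≈ 0#
    B-vanishes = det-adjacent-equal-columns (suc n) B (inject₁ q) (Fin.suc q) (≡.cong suc (≡.sym (Finₚ.toℕ-inject₁ q)))
      (λ r → reflexive (≡.trans (Vectorₚ.updateAt-minimal _ _ (A r) inject₁q≢sucq) (≡.sym (Vectorₚ.updateAt-updates (Fin.suc q) (A r)))))

  det-scale-rows : ∀ n (s : Fin n → Carrier) (A : Matrix n) →
    det R h n (λ r c → s r * A r c) ≈ prodFin R h n s * det R h n A
  det-scale-rows zero    s A = sym (*-identityʳ 1#)
  det-scale-rows (suc n) s A rewrite prodFin-suc n s =
    trans (∑-cong (allFin (suc n)) term-scaled) (∑-*ˡ (allFin (suc n)) _ _)
    where
    s′ = λ r → s (Fin.suc r)
    term-scaled : ∀ j → cofactorTerm (λ r c → s r * A r c) j ≈ (s Fin.zero * prodFin R h n s′) * cofactorTerm A j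
    term-scaled j = trans (scale-congʳ (sign R h (toℕ j)) (begin
      (s Fin.zero * A Fin.zero j) * det R h n (λ r c → s′ r * minor A j r c)
        ≈⟨ *-congˡ (det-scale-rows n s′ (minor A j)) ⟩
      (s Fin.zero * A Fin.zero j) * (prodFin R h n s′ * det R h n (minor A j))
        ≈⟨ *-interchange _ _ _ _ ⟩
      (s Fin.zero * prodFin R h n s′) * (A Fin.zero j * det R h n (minor A j)) ∎))
      (scale-*-comm (sign R h (toℕ j)) _ _)

  det-first-row-unit : ∀ n (A : Matrix (suc n)) → (∀ j → j ≢ Fin.zero → A Fin.zero j ≈ 0#) →
    det R h (suc n) A ≈ A Fin.zero Fin.zero * det R h n (λ r c → A (Fin.suc r) (Fin.suc c))
  det-first-row-unit n A row₀ = trans (sumFin-single (suc n) (cofactorTerm A) Fin.zero other-terms-vanish) (scale-1 _)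
    where
    other-terms-vanish : ∀ j → j ≢ Fin.zero → cofactorTerm A j ≈ 0#
    other-terms-vanish j j≢0 =
      trans (scale-congʳ (sign R h (toℕ j)) (trans (*-congʳ (row₀ j j≢0)) (zeroˡ _))) (scale-0# (sign R h (toℕ j)))

  open import Algebra.Properties.Semiring.Exp semiring public using (_^_)

  module VandermondeReduction (n : ℕ) (x : Fin (suc n) → Carrier) where

    reduced : Matrix (suc n)
    reduced r Fin.zero    = 1#
    reduced r (Fin.suc c) = x r ^ toℕ c * (x r - x Fin.zero)

    -- column c minus x₀ times column c - 1, performed on the columns c ≥ k
    stage : ℕ → Matrix (suc n)
    stage k r c = if ⌊ k ℕ.≤? toℕ c ⌋ then reduced r c else x r ^ toℕ c

    stage-step : ∀ (q : Fin n) → det R h (suc n) (stage (suc (toℕ q))) ≈ det R h (suc n) (stage (suc (suc (toℕ q))))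
    stage-step q = det-add-left-column-multiple n (stage (suc (suc k))) (stage (suc k)) q (- x Fin.zero) unchanged changed
      where
      k = toℕ q
      unchanged : ∀ r c → c ≢ Fin.suc q → stage (suc k) r c ≈ stage (suc (suc k)) r c
      unchanged r c c≢q = reflexive (≡.cong (λ b → if b then reduced r c else x r ^ toℕ c)
        (⌊≤?⌋-suc (suc k) (toℕ c) (c≢q ∘ Finₚ.toℕ-injective)))
      changed : ∀ r → stage (suc k) r (Fin.suc q) ≈ stage (suc (suc k)) r (Fin.suc q) + - x Fin.zero * stage (suc (suc k)) r (inject₁ q)
      changed r
        rewrite ⌊⌋-yes (suc k ℕ.≤? suc k) ℕₚ.≤-refl
              | ⌊⌋-no (suc (suc k) ℕ.≤? suc k) (ℕₚ.<-irrefl ≡.refl)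
              | ⌊⌋-no (suc (suc k) ℕ.≤? toℕ (inject₁ q)) (λ le → ℕₚ.<⇒≱ (ℕₚ.<-trans (ℕₚ.n<1+n k) le) (ℕₚ.≤-reflexive (Finₚ.toℕ-inject₁ q)))
              | Finₚ.toℕ-inject₁ q
              = solve 3 (λ p y y₀ → p :* (y :- y₀) := y :* p :+ (:- y₀) :* p) refl (x r ^ k) (x r) (x Fin.zero)

    det-stage : ∀ k → k ℕ.≤ n → det R h (suc n) (stage 1) ≈ det R h (suc n) (stage (suc k))
    det-stage zero    _   = refl
    det-stage (suc k) k<n = trans (det-stage k (ℕₚ.<⇒≤ k<n))
      (≡.subst (λ i → det R h (suc n) (stage (suc i)) ≈ det R h (suc n) (stage (suc (suc i))))
               (Finₚ.toℕ-fromℕ< k<n) (stage-step (Fin.fromℕ< k<n)))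

    stage-last : ∀ r c → stage (suc n) r c ≈ x r ^ toℕ c
    stage-last r c rewrite ⌊⌋-no (suc n ℕ.≤? toℕ c) (ℕₚ.<⇒≱ (Finₚ.toℕ<n c)) = refl

    det-stage-first : det R h (suc n) (stage 1) ≈
      prodFin R h n (λ r → x (Fin.suc r) - x Fin.zero) * det R h n (λ r c → x (Fin.suc r) ^ toℕ c)
    det-stage-first = begin
      det R h (suc n) (stage 1)
        ≈⟨ det-first-row-unit n (stage 1) row₀ ⟩
      1# * det R h n (λ r c → x (Fin.suc r) ^ toℕ c * (x (Fin.suc r) - x Fin.zero))
        ≈⟨ *-identityˡ _ ⟩
      det R h n (λ r c → x (Fin.suc r) ^ toℕ c * (x (Fin.suc r) - x Fin.zero))
        ≈⟨ det-cong n (λ r c → *-comm _ _) ⟩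
      det R h n (λ r c → (x (Fin.suc r) - x Fin.zero) * x (Fin.suc r) ^ toℕ c)
        ≈⟨ det-scale-rows n _ _ ⟩
      prodFin R h n (λ r → x (Fin.suc r) - x Fin.zero) * det R h n (λ r c → x (Fin.suc r) ^ toℕ c) ∎
      where
      row₀ : ∀ j → j ≢ Fin.zero → stage 1 Fin.zero j ≈ 0#
      row₀ Fin.zero    j≢0 = ⊥-elim (j≢0 ≡.refl)
      row₀ (Fin.suc j) _   = trans (*-congˡ (-‿inverseʳ _)) (zeroʳ _)

  det-vandermonde-suc : ∀ n (x : Fin (suc n) → Carrier) →
    det R h (suc n) (λ r c → x r ^ toℕ c) ≈
    prodFin R h n (λ r → x (Fin.suc r) - x Fin.zero) * det R h n (λ r c → x (Fin.suc r) ^ toℕ c)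
  det-vandermonde-suc n x = begin
    det R h (suc n) (λ r c → x r ^ toℕ c)  ≈⟨ det-cong (suc n) stage-last ⟨
    det R h (suc n) (stage (suc n))        ≈⟨ det-stage n ℕₚ.≤-refl ⟨
    det R h (suc n) (stage 1)              ≈⟨ det-stage-first ⟩
    _                                      ∎
    where open VandermondeReduction n x

  rootFactor : ∀ {n} (g : Fin n × Fin n → Carrier) → Fin n → Fin n → Carrier
  rootFactor g i j = ∏ (if ⌊ i Finₚ.<? j ⌋ then [ (i , j) ] else []) g

  ∏-posRoots : ∀ n (g : Fin n × Fin n → Carrier) → ∏ (posRoots n) g ≈ prodFin R h n (λ i → prodFin R h n (rootFactor g i))
  ∏-posRoots n g = trans (∏-concatMap (allFin n) _ g) (∏-cong (allFin n) (λ i → ∏-concatMap (allFin n) _ g))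

  ∏-posRoots-suc : ∀ n (g : Fin (suc n) × Fin (suc n) → Carrier) →
    ∏ (posRoots (suc n)) g ≈
    prodFin R h n (λ j → g (Fin.zero , Fin.suc j)) * ∏ (posRoots n) (λ (i , j) → g (Fin.suc i , Fin.suc j))
  ∏-posRoots-suc n g = begin
    ∏ (posRoots (suc n)) g
      ≈⟨ ∏-posRoots (suc n) g ⟩
    prodFin R h (suc n) (λ i → prodFin R h (suc n) (rootFactor g i))
      ≡⟨ prodFin-suc n _ ⟩
    prodFin R h (suc n) (rootFactor g Fin.zero) * prodFin R h n (λ i → prodFin R h (suc n) (rootFactor g (Fin.suc i)))
      ≈⟨ *-cong first-row other-rows ⟩
    prodFin R h n (λ j → g (Fin.zero , Fin.suc j)) * ∏ (posRoots n) g′ ∎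
    where
    g′ : Fin n × Fin n → Carrier
    g′ (i , j) = g (Fin.suc i , Fin.suc j)
    diagonal : ∀ i → rootFactor g i i ≈ 1#
    diagonal i rewrite ⌊⌋-no (i Finₚ.<? i) (ℕₚ.<-irrefl ≡.refl) = refl
    below-first : ∀ i → rootFactor g (Fin.suc i) Fin.zero ≈ 1#
    below-first i rewrite ⌊⌋-no (Fin.suc i Finₚ.<? Fin.zero {n}) (λ ()) = refl
    first-row-entry : ∀ j → rootFactor g Fin.zero (Fin.suc j) ≈ g (Fin.zero , Fin.suc j)
    first-row-entry j rewrite ⌊⌋-yes (Fin.zero {n} Finₚ.<? Fin.suc j) (ℕ.s≤s ℕ.z≤n) = *-identityʳ _
    shifted-entry : ∀ i j → rootFactor g (Fin.suc i) (Fin.suc j) ≡ rootFactor g′ i j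
    shifted-entry i j rewrite ⌊<?⌋-suc i j with ⌊ i Finₚ.<? j ⌋
    ... | true  = ≡.refl
    ... | false = ≡.refl
    first-row : prodFin R h (suc n) (rootFactor g Fin.zero) ≈ prodFin R h n (λ j → g (Fin.zero , Fin.suc j))
    first-row = trans (reflexive (prodFin-suc n _)) (trans (*-cong (diagonal Fin.zero) (∏-cong (allFin n) first-row-entry)) (*-identityˡ _))
    other-rows : prodFin R h n (λ i → prodFin R h (suc n) (rootFactor g (Fin.suc i))) ≈ ∏ (posRoots n) g′
    other-rows = trans (∏-cong (allFin n) (λ i → trans (reflexive (prodFin-suc n _))
                   (trans (*-cong (below-first i) (∏-cong (allFin n) (reflexive ∘ shifted-entry i))) (*-identityˡ _))))
                 (sym (∏-posRoots n g′))

  ∏-posRoots-snd : ∀ n (y : Fin n → Carrier) → ∏ (posRoots n) (λ (i , j) → y j) ≈ prodFin R h n (λ r → y r ^ toℕ r)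
  ∏-posRoots-snd zero    y = refl
  ∏-posRoots-snd (suc n) y = begin
    ∏ (posRoots (suc n)) (λ (i , j) → y j)
      ≈⟨ ∏-posRoots-suc n _ ⟩
    prodFin R h n (λ j → y (Fin.suc j)) * ∏ (posRoots n) (λ (i , j) → y (Fin.suc j))
      ≈⟨ *-congˡ (∏-posRoots-snd n (y ∘ Fin.suc)) ⟩
    prodFin R h n (λ j → y (Fin.suc j)) * prodFin R h n (λ r → y (Fin.suc r) ^ toℕ r)
      ≈⟨ ∏-distrib-* (allFin n) _ _ ⟨
    prodFin R h n (λ r → y (Fin.suc r) ^ suc (toℕ r))
      ≈⟨ *-identityˡ _ ⟨
    1# * prodFin R h n (λ r → y (Fin.suc r) ^ suc (toℕ r))
      ≡⟨ prodFin-suc n _ ⟨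
    prodFin R h (suc n) (λ r → y r ^ toℕ r) ∎

  det-vandermonde : ∀ n (x : Fin n → Carrier) →
    det R h n (λ r c → x r ^ toℕ c) ≈ ∏ (posRoots n) (λ (i , j) → x j - x i)
  det-vandermonde zero    x = refl
  det-vandermonde (suc n) x = begin
    det R h (suc n) (λ r c → x r ^ toℕ c)
      ≈⟨ det-vandermonde-suc n x ⟩
    prodFin R h n (λ r → x (Fin.suc r) - x Fin.zero) * det R h n (λ r c → x (Fin.suc r) ^ toℕ c)
      ≈⟨ *-congˡ (det-vandermonde n (x ∘ Fin.suc)) ⟩
    prodFin R h n (λ r → x (Fin.suc r) - x Fin.zero) * ∏ (posRoots n) (λ (i , j) → x (Fin.suc j) - x (Fin.suc i))
      ≈⟨ ∏-posRoots-suc n _ ⟨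
    ∏ (posRoots (suc n)) (λ (i , j) → x j - x i) ∎

  -- with y = x⁻¹ this is det (x_r^(c - r)) = ∏_{i<j} (1 - x_i / x_j)
  det-vandermonde-inverse : ∀ n (x y : Fin n → Carrier) → (∀ r → x r * y r ≈ 1#) →
    det R h n (λ r c → x r ^ toℕ c * y r ^ toℕ r) ≈ ∏ (posRoots n) (λ (i , j) → 1# - x i * y j)
  det-vandermonde-inverse n x y xy≈1 = begin
    det R h n (λ r c → x r ^ toℕ c * y r ^ toℕ r)
      ≈⟨ det-cong n (λ r c → *-comm _ _) ⟩
    det R h n (λ r c → y r ^ toℕ r * x r ^ toℕ c)
      ≈⟨ det-scale-rows n (λ r → y r ^ toℕ r) _ ⟩
    prodFin R h n (λ r → y r ^ toℕ r) * det R h n (λ r c → x r ^ toℕ c)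
      ≈⟨ *-cong (sym (∏-posRoots-snd n y)) (det-vandermonde n x) ⟩
    ∏ (posRoots n) (λ (i , j) → y j) * ∏ (posRoots n) (λ (i , j) → x j - x i)
      ≈⟨ ∏-distrib-* (posRoots n) _ _ ⟨
    ∏ (posRoots n) (λ (i , j) → y j * (x j - x i))
      ≈⟨ ∏-cong (posRoots n) factor ⟩
    ∏ (posRoots n) (λ (i , j) → 1# - x i * y j) ∎
    where
    factor : ∀ ((i , j) : Fin n × Fin n) → y j * (x j - x i) ≈ 1# - x i * y j
    factor (i , j) = trans (solve 3 (λ v u w → v :* (u :- w) := u :* v :- w :* v) refl (y j) (x j) (x i)) (+-congʳ (xy≈1 j))

-- A formal sum p ∈ LP ℓ is identified with every other formal sum on which each
-- extensional F : Exp ℓ → R has the same ℤ-linear extension; this makes LP ℓ a commutative ring.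
module LaurentPolynomials {a b} (R : CommutativeRing a b) (h : ℕ → CommutativeRing.Carrier R) (ℓ : ℕ) where
  open CommutativeRing R
  open RingProperties ring using (-0#≈0#)
  open AbelianGroupProperties +-abelianGroup using (⁻¹-∙-comm)
  open CommutativeSemigroupProperties +-commutativeSemigroup using () renaming (interchange to +-interchange)
  open IntegerScaling R h
  open SetoidReasoning setoid

  Extensional : (Exp ℓ → Carrier) → Set b
  Extensional F = ∀ α β → (∀ k → α k ≡ β k) → F α ≈ F β

  linearExt : (Exp ℓ → Carrier) → LP ℓ → Carrier
  linearExt F []            = 0#
  linearExt F ((c , α) ∷ p) = scale R h c (F α) + linearExt F p

  infix 4 _≃_
  record _≃_ (p q : LP ℓ) : Set (a ⊔ b) where
    constructor mk≃
    field linearExt-≈ : ∀ F → Extensional F → linearExt F p ≈ linearExt F q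
  open _≃_ public

  negate : LP ℓ → LP ℓ
  negate = map (λ (c , α) → (ℤ.- c , α))

  shift-extensional : ∀ {F} → Extensional F → ∀ α → Extensional (λ β → F (α +E β))
  shift-extensional F-ext α β β′ β≡β′ = F-ext _ _ (λ k → ≡.cong (λ w → α k ℤ.+ w) (β≡β′ k))

  linearExt-congˡ : ∀ p {F G} → (∀ α → F α ≈ G α) → linearExt F p ≈ linearExt G p
  linearExt-congˡ []            F≈G = refl
  linearExt-congˡ ((c , α) ∷ p) F≈G = +-cong (scale-congʳ c (F≈G α)) (linearExt-congˡ p F≈G)

  linearExt-extensional : ∀ q {F} → Extensional F → Extensional (λ α → linearExt (λ β → F (α +E β)) q)
  linearExt-extensional q F-ext α α′ α≡α′ = linearExt-congˡ q (λ β → F-ext _ _ (λ k → ≡.cong (λ w → w ℤ.+ β k) (α≡α′ k)))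

  linearExt-++ : ∀ p q F → linearExt F (p ++ q) ≈ linearExt F p + linearExt F q
  linearExt-++ []            q F = sym (+-identityˡ _)
  linearExt-++ ((c , α) ∷ p) q F = trans (+-congˡ (linearExt-++ p q F)) (sym (+-assoc _ _ _))

  linearExt-zero : ∀ p → linearExt (λ _ → 0#) p ≈ 0#
  linearExt-zero []            = refl
  linearExt-zero ((c , α) ∷ p) = trans (+-cong (scale-0# c) (linearExt-zero p)) (+-identityʳ 0#)

  linearExt-vanishes : ∀ {P : Exp ℓ → Set} F q → All (P ∘ proj₂) q → (∀ β → P β → F β ≈ 0#) → linearExt F q ≈ 0#
  linearExt-vanishes F []            []         F≈0 = refl
  linearExt-vanishes F ((c , α) ∷ q) (Pα ∷ Pq) F≈0 =
    trans (+-cong (trans (scale-congʳ c (F≈0 α Pα)) (scale-0# c)) (linearExt-vanishes F q Pq F≈0)) (+-identityʳ 0#)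

  linearExt-+ : ∀ p F G → linearExt (λ α → F α + G α) p ≈ linearExt F p + linearExt G p
  linearExt-+ []            F G = sym (+-identityʳ 0#)
  linearExt-+ ((c , α) ∷ p) F G = trans (+-cong (scale-+ c _ _) (linearExt-+ p F G)) (+-interchange _ _ _ _)

  linearExt-scale : ∀ p z F → linearExt (λ α → scale R h z (F α)) p ≈ scale R h z (linearExt F p)
  linearExt-scale []            z F = sym (scale-0# z)
  linearExt-scale ((c , α) ∷ p) z F = trans (+-cong scale-comm (linearExt-scale p z F)) (sym (scale-+ z _ _))
    where
    scale-comm : scale R h c (scale R h z (F α)) ≈ scale R h z (scale R h c (F α))
    scale-comm = trans (sym (scale-homo-* c z _)) (trans (reflexive (≡.cong (λ w → scale R h w (F α)) (ℤₚ.*-comm c z))) (scale-homo-* z c _))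

  linearExt-negate : ∀ p F → linearExt F (negate p) ≈ - linearExt F p
  linearExt-negate []            F = sym -0#≈0#
  linearExt-negate ((c , α) ∷ p) F = trans (+-cong (scale-negˡ c (F α)) (linearExt-negate p F)) (⁻¹-∙-comm _ _)

  linearExt-⊗ : ∀ p q F → linearExt F (p ⊗ q) ≈ linearExt (λ α → linearExt (λ β → F (α +E β)) q) p
  linearExt-⊗ []            q F = refl
  linearExt-⊗ ((c , α) ∷ p) q F = trans (linearExt-++ (map _ q) (p ⊗ q) F) (+-cong (row q) (linearExt-⊗ p q F))
    where
    row : ∀ q → linearExt F (map (λ (d , β) → (c ℤ.* d , α +E β)) q) ≈ scale R h c (linearExt (λ β → F (α +E β)) q)
    row []            = sym (scale-0# c)
    row ((d , β) ∷ q) = trans (+-cong (scale-homo-* c d _) (row q)) (sym (scale-+ c _ _))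

  linearExt-swap : ∀ p q (H : Exp ℓ → Exp ℓ → Carrier) →
    linearExt (λ α → linearExt (H α) q) p ≈ linearExt (λ β → linearExt (λ α → H α β) p) q
  linearExt-swap []            q H = sym (linearExt-zero q)
  linearExt-swap ((c , α) ∷ p) q H =
    trans (+-cong (sym (linearExt-scale q c (H α))) (linearExt-swap p q H)) (sym (linearExt-+ q _ _))

  linearExt-monomial : ∀ F γ → linearExt F (monomial γ) ≈ F γ
  linearExt-monomial F γ = trans (+-identityʳ _) (scale-1 _)

  linearExt-monomial-⊗ : ∀ δ q F → linearExt F (monomial δ ⊗ q) ≈ linearExt (λ β → F (δ +E β)) q
  linearExt-monomial-⊗ δ q F = trans (linearExt-⊗ (monomial δ) q F) (linearExt-monomial (λ α → linearExt (λ β → F (α +E β)) q) δ)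

  ≃-refl : ∀ {p} → p ≃ p
  ≃-refl = mk≃ λ _ _ → refl

  ≃-sym : ∀ {p q} → p ≃ q → q ≃ p
  ≃-sym p≃q = mk≃ λ F F-ext → sym (linearExt-≈ p≃q F F-ext)

  ≃-trans : ∀ {p q s} → p ≃ q → q ≃ s → p ≃ s
  ≃-trans p≃q q≃s = mk≃ λ F F-ext → trans (linearExt-≈ p≃q F F-ext) (linearExt-≈ q≃s F F-ext)

  ≃-reflexive : ∀ {p q} → p ≡ q → p ≃ q
  ≃-reflexive ≡.refl = ≃-refl

  ++-cong : ∀ {p p′ q q′} → p ≃ p′ → q ≃ q′ → (p ++ q) ≃ (p′ ++ q′)
  ++-cong {p} {p′} {q} {q′} p≃p′ q≃q′ = mk≃ λ F F-ext → begin
    linearExt F (p ++ q)                  ≈⟨ linearExt-++ p q F ⟩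
    linearExt F p + linearExt F q         ≈⟨ +-cong (linearExt-≈ p≃p′ F F-ext) (linearExt-≈ q≃q′ F F-ext) ⟩
    linearExt F p′ + linearExt F q′       ≈⟨ linearExt-++ p′ q′ F ⟨
    linearExt F (p′ ++ q′)                ∎

  ⊗-cong : ∀ {p p′ q q′} → p ≃ p′ → q ≃ q′ → (p ⊗ q) ≃ (p′ ⊗ q′)
  ⊗-cong {p} {p′} {q} {q′} p≃p′ q≃q′ = mk≃ λ F F-ext → begin
    linearExt F (p ⊗ q)                                        ≈⟨ linearExt-⊗ p q F ⟩
    linearExt (λ α → linearExt (λ β → F (α +E β)) q) p         ≈⟨ linearExt-congˡ p (λ α → linearExt-≈ q≃q′ _ (shift-extensional F-ext α)) ⟩
    linearExt (λ α → linearExt (λ β → F (α +E β)) q′) p        ≈⟨ linearExt-≈ p≃p′ _ (linearExt-extensional q′ F-ext) ⟩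
    linearExt (λ α → linearExt (λ β → F (α +E β)) q′) p′       ≈⟨ linearExt-⊗ p′ q′ F ⟨
    linearExt F (p′ ⊗ q′)                                      ∎

  negate-cong : ∀ {p q} → p ≃ q → negate p ≃ negate q
  negate-cong {p} {q} p≃q = mk≃ λ F F-ext →
    trans (linearExt-negate p F) (trans (-‿cong (linearExt-≈ p≃q F F-ext)) (sym (linearExt-negate q F)))

  ++-comm : ∀ p q → (p ++ q) ≃ (q ++ p)
  ++-comm p q = mk≃ λ F _ → trans (linearExt-++ p q F) (trans (+-comm _ _) (sym (linearExt-++ q p F)))

  negate-inverseˡ : ∀ p → (negate p ++ p) ≃ []
  negate-inverseˡ p = mk≃ λ F _ → trans (linearExt-++ (negate p) p F) (trans (+-congʳ (linearExt-negate p F)) (-‿inverseˡ _))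

  negate-inverseʳ : ∀ p → (p ++ negate p) ≃ []
  negate-inverseʳ p = mk≃ λ F _ → trans (linearExt-++ p (negate p) F) (trans (+-congˡ (linearExt-negate p F)) (-‿inverseʳ _))

  ⊗-assoc : ∀ p q s → ((p ⊗ q) ⊗ s) ≃ (p ⊗ (q ⊗ s))
  ⊗-assoc p q s = mk≃ λ F F-ext → begin
    linearExt F ((p ⊗ q) ⊗ s)
      ≈⟨ linearExt-⊗ (p ⊗ q) s F ⟩
    linearExt (λ α → linearExt (λ γ → F (α +E γ)) s) (p ⊗ q)
      ≈⟨ linearExt-⊗ p q _ ⟩
    linearExt (λ α → linearExt (λ β → linearExt (λ γ → F ((α +E β) +E γ)) s) q) p
      ≈⟨ linearExt-congˡ p (λ α → linearExt-congˡ q (λ β → linearExt-congˡ s (λ γ →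
           F-ext _ _ (λ k → ℤₚ.+-assoc (α k) (β k) (γ k))))) ⟩
    linearExt (λ α → linearExt (λ β → linearExt (λ γ → F (α +E (β +E γ))) s) q) p
      ≈⟨ linearExt-congˡ p (λ α → linearExt-⊗ q s (λ δ → F (α +E δ))) ⟨
    linearExt (λ α → linearExt (λ δ → F (α +E δ)) (q ⊗ s)) p
      ≈⟨ linearExt-⊗ p (q ⊗ s) F ⟨
    linearExt F (p ⊗ (q ⊗ s)) ∎

  ⊗-comm : ∀ p q → (p ⊗ q) ≃ (q ⊗ p)
  ⊗-comm p q = mk≃ λ F F-ext → begin
    linearExt F (p ⊗ q)                                    ≈⟨ linearExt-⊗ p q F ⟩
    linearExt (λ α → linearExt (λ β → F (α +E β)) q) p     ≈⟨ linearExt-swap p q _ ⟩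
    linearExt (λ β → linearExt (λ α → F (α +E β)) p) q     ≈⟨ linearExt-congˡ q (λ β → linearExt-congˡ p (λ α →
                                                                F-ext _ _ (λ k → ℤₚ.+-comm (α k) (β k)))) ⟩
    linearExt (λ β → linearExt (λ α → F (β +E α)) p) q     ≈⟨ linearExt-⊗ q p F ⟨
    linearExt F (q ⊗ p)                                    ∎

  ⊗-identityˡ : ∀ p → (oneLP ⊗ p) ≃ p
  ⊗-identityˡ p = mk≃ λ F F-ext → trans (linearExt-monomial-⊗ zeroE p F)
    (linearExt-congˡ p (λ β → F-ext _ _ (λ k → ℤₚ.+-identityˡ (β k))))

  ⊗-identityʳ : ∀ p → (p ⊗ oneLP) ≃ p
  ⊗-identityʳ p = ≃-trans (⊗-comm p oneLP) (⊗-identityˡ p)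

  ⊗-distribˡ-++ : ∀ p q s → (p ⊗ (q ++ s)) ≃ ((p ⊗ q) ++ (p ⊗ s))
  ⊗-distribˡ-++ p q s = mk≃ λ F _ → begin
    linearExt F (p ⊗ (q ++ s))
      ≈⟨ linearExt-⊗ p (q ++ s) F ⟩
    linearExt (λ α → linearExt (λ β → F (α +E β)) (q ++ s)) p
      ≈⟨ linearExt-congˡ p (λ α → linearExt-++ q s _) ⟩
    linearExt (λ α → linearExt (λ β → F (α +E β)) q + linearExt (λ β → F (α +E β)) s) p
      ≈⟨ linearExt-+ p _ _ ⟩
    linearExt (λ α → linearExt (λ β → F (α +E β)) q) p + linearExt (λ α → linearExt (λ β → F (α +E β)) s) p
      ≈⟨ +-cong (linearExt-⊗ p q F) (linearExt-⊗ p s F) ⟨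
    linearExt F (p ⊗ q) + linearExt F (p ⊗ s)
      ≈⟨ linearExt-++ (p ⊗ q) (p ⊗ s) F ⟨
    linearExt F ((p ⊗ q) ++ (p ⊗ s)) ∎

  ⊗-distribʳ-++ : ∀ p q s → ((q ++ s) ⊗ p) ≃ ((q ⊗ p) ++ (s ⊗ p))
  ⊗-distribʳ-++ p q s = mk≃ λ F _ → begin
    linearExt F ((q ++ s) ⊗ p)                   ≈⟨ linearExt-⊗ (q ++ s) p F ⟩
    linearExt (λ α → linearExt (λ β → F (α +E β)) p) (q ++ s)
                                                 ≈⟨ linearExt-++ q s _ ⟩
    linearExt (λ α → linearExt (λ β → F (α +E β)) p) q + linearExt (λ α → linearExt (λ β → F (α +E β)) p) s
                                                 ≈⟨ +-cong (linearExt-⊗ q p F) (linearExt-⊗ s p F) ⟨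
    linearExt F (q ⊗ p) + linearExt F (s ⊗ p)    ≈⟨ linearExt-++ (q ⊗ p) (s ⊗ p) F ⟨
    linearExt F ((q ⊗ p) ++ (s ⊗ p))             ∎

  ≃-isCommutativeRing : IsCommutativeRing _≃_ _++_ _⊗_ negate [] oneLP
  ≃-isCommutativeRing = record
    { isRing = record
      { +-isAbelianGroup = record
        { isGroup = record
          { isMonoid = record
            { isSemigroup = record
              { isMagma = record
                { isEquivalence = record { refl = ≃-refl ; sym = ≃-sym ; trans = ≃-trans }
                ; ∙-cong        = ++-cong
                }
              ; assoc = λ p q s → ≃-reflexive (Listₚ.++-assoc p q s)
              }
            ; identity = (λ _ → ≃-refl) , (λ p → ≃-reflexive (Listₚ.++-identityʳ p))
            }
          ; inverse = negate-inverseˡ , negate-inverseʳ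
          ; ⁻¹-cong = negate-cong
          }
        ; comm = ++-comm
        }
      ; *-cong     = ⊗-cong
      ; *-assoc    = ⊗-assoc
      ; *-identity = ⊗-identityˡ , ⊗-identityʳ
      ; distrib    = ⊗-distribˡ-++ , ⊗-distribʳ-++
      }
    ; *-comm = ⊗-comm
    }

  LaurentRing : CommutativeRing 0ℓ (a ⊔ b)
  LaurentRing = record { isCommutativeRing = ≃-isCommutativeRing }

unitE-same : ∀ {ℓ} (i : Fin ℓ) → unitE i i ≡ + 1
unitE-same i = ≡.cong (λ b → if b then + 1 else + 0) (⌊⌋-yes (i Finₚ.≟ i) ≡.refl)

unitE-other : ∀ {ℓ} (i k : Fin ℓ) → k ≢ i → unitE i k ≡ + 0
unitE-other i k k≢i = ≡.cong (λ b → if b then + 1 else + 0) (⌊⌋-no (k Finₚ.≟ i) k≢i)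

+E-*E-unitE-same : ∀ {ℓ} (α : Exp ℓ) m i → (α +E (m *E unitE i)) i ≡ α i ℤ.+ m
+E-*E-unitE-same α m i = ≡.trans (≡.cong (λ u → α i ℤ.+ m ℤ.* u) (unitE-same i)) (≡.cong (λ w → α i ℤ.+ w) (ℤₚ.*-identityʳ m))

+E-*E-unitE-other : ∀ {ℓ} (α : Exp ℓ) m i k → k ≢ i → (α +E (m *E unitE i)) k ≡ α k
+E-*E-unitE-other α m i k k≢i =
  ≡.trans (≡.cong (λ u → α k ℤ.+ m ℤ.* u) (unitE-other i k k≢i))
          (≡.trans (≡.cong (λ w → α k ℤ.+ w) (ℤₚ.*-zeroʳ m)) (ℤₚ.+-identityʳ (α k)))

module MonomialDeterminant {a b} (R : CommutativeRing a b) (h : ℕ → CommutativeRing.Carrier R) (ℓ : ℕ) where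
  open CommutativeRing R
  open IntegerScaling R h
  open BigOperators R h
  open Determinant R h using (det-cong)
  open LaurentPolynomials R h ℓ
  open SetoidReasoning setoid

  -- the parameter h of the ring operations in Defs is never used; LaurentRing gets a dummy
  noH : ℕ → LP ℓ
  noH _ = []

  linearExt-sum : ∀ {A : Set} (xs : List A) (g : A → LP ℓ) F →
    linearExt F (sumList LaurentRing noH (map g xs)) ≈ ∑ xs (λ x → linearExt F (g x))
  linearExt-sum []       g F = refl
  linearExt-sum (x ∷ xs) g F = trans (linearExt-++ (g x) _ F) (+-congˡ (linearExt-sum xs g F))

  linearExt-natTimes : ∀ n p F → linearExt F (natTimes LaurentRing noH n p) ≈ natTimes R h n (linearExt F p)
  linearExt-natTimes zero    p F = refl
  linearExt-natTimes (suc n) p F = trans (linearExt-++ p _ F) (+-congˡ (linearExt-natTimes n p F))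

  linearExt-scaleᴸ : ∀ z p F → linearExt F (scale LaurentRing noH z p) ≈ scale R h z (linearExt F p)
  linearExt-scaleᴸ (+ n)    p F = linearExt-natTimes n p F
  linearExt-scaleᴸ -[1+ n ] p F =
    trans (linearExt-negate (natTimes LaurentRing noH (suc n) p) F) (-‿cong (linearExt-natTimes (suc n) p F))

  sign≡sign : ∀ n → sign LaurentRing noH n ≡ sign R h n
  sign≡sign zero    = ≡.refl
  sign≡sign (suc n) = ≡.cong ℤ.-_ (sign≡sign n)

  Independent : ∀ {n} → (Fin n → Fin ℓ) → (Exp ℓ → Carrier) → Set b
  Independent σ Φ = ∀ β β′ → (∀ k → (∀ r → σ r ≢ k) → β k ≡ β′ k) → Φ β ≈ Φ β′

  monomialMatrix : ∀ n → (Fin n → Fin ℓ) → (Fin n → Fin n → ℤ) → Fin n → Fin n → LP ℓ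
  monomialMatrix n σ μ r c = monomial (μ r c *E unitE (σ r))

  module _ (f : Fin ℓ → ℤ → Carrier) where

    weight : ∀ n → (Fin n → Fin ℓ) → (Exp ℓ → Carrier) → Exp ℓ → Carrier
    weight n σ Φ β = Φ β * prodFin R h n (λ r → f (σ r) (β (σ r)))

    weight-extensional : ∀ n σ {Φ} → Independent σ Φ → Extensional (weight n σ Φ)
    weight-extensional n σ Φ-ind β β′ β≡β′ =
      *-cong (Φ-ind β β′ (λ k _ → β≡β′ k)) (∏-cong (allFin n) (λ r → reflexive (≡.cong (f (σ r)) (β≡β′ (σ r)))))

    weight-suc : ∀ n σ Φ β → weight (suc n) σ Φ β ≈ weight n (σ ∘ Fin.suc) (λ γ → Φ γ * f (σ Fin.zero) (γ (σ Fin.zero))) β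
    weight-suc n σ Φ β = trans (*-congˡ (reflexive (prodFin-suc n _))) (sym (*-assoc _ _ _))

    -- The key point of the induction: a monomial in the variable of row 0 only shifts the argument
    -- of the factor f (σ 0) of the weight, which therefore moves into the row-independent part Φ.
    linearExt-det-monomial : ∀ n (σ : Fin n → Fin ℓ) → (∀ r s → σ r ≡ σ s → r ≡ s) → ∀ μ Φ → Independent σ Φ → ∀ α →
      linearExt (λ β → weight n σ Φ (α +E β)) (det LaurentRing noH n (monomialMatrix n σ μ))
        ≈ Φ α * det R h n (λ r c → f (σ r) (α (σ r) ℤ.+ μ r c))
    linearExt-det-monomial zero    σ σ-inj μ Φ Φ-ind α =
      trans (linearExt-monomial (λ β → weight 0 σ Φ (α +E β)) zeroE) (*-congʳ (Φ-ind _ _ (λ k _ → ℤₚ.+-identityʳ (α k))))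
    linearExt-det-monomial (suc n) σ σ-inj μ Φ Φ-ind α =
      trans (linearExt-sum (allFin (suc n)) expansionTerm (λ β → weight (suc n) σ Φ (α +E β)))
            (trans (∑-cong (allFin (suc n)) term) (∑-*ˡ (allFin (suc n)) (Φ α) _))
      where
      σ′ : Fin n → Fin ℓ
      σ′ = σ ∘ Fin.suc
      σ′≢σ₀ : ∀ r → σ′ r ≢ σ Fin.zero
      σ′≢σ₀ r eq with σ-inj _ _ eq
      ... | ()
      Φ′ : Exp ℓ → Carrier
      Φ′ γ = Φ γ * f (σ Fin.zero) (γ (σ Fin.zero))
      Φ′-ind : Independent σ′ Φ′
      Φ′-ind β β′ agree = *-cong (Φ-ind β β′ (λ k k∉σ → agree k (k∉σ ∘ Fin.suc)))
        (reflexive (≡.cong (f (σ Fin.zero)) (agree (σ Fin.zero) σ′≢σ₀)))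
      expansionTerm : Fin (suc n) → LP ℓ
      expansionTerm j = scale LaurentRing noH (sign LaurentRing noH (toℕ j))
        (monomialMatrix (suc n) σ μ Fin.zero j ⊗ det LaurentRing noH n (λ r c → monomialMatrix (suc n) σ μ (Fin.suc r) (punchIn j c)))
      term : ∀ j → linearExt (λ β → weight (suc n) σ Φ (α +E β)) (expansionTerm j) ≈ Φ α * scale R h (sign R h (toℕ j))
            (f (σ Fin.zero) (α (σ Fin.zero) ℤ.+ μ Fin.zero j) * det R h n (λ r c → f (σ′ r) (α (σ′ r) ℤ.+ μ (Fin.suc r) (punchIn j c))))
      term j rewrite sign≡sign (toℕ j) = begin
        linearExt W (scale LaurentRing noH s (monomial δ ⊗ M))
          ≈⟨ linearExt-scaleᴸ s _ W ⟩
        scale R h s (linearExt W (monomial δ ⊗ M))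
          ≈⟨ scale-congʳ s (linearExt-monomial-⊗ δ M W) ⟩
        scale R h s (linearExt (λ β → W (δ +E β)) M)
          ≈⟨ scale-congʳ s (linearExt-congˡ M shift) ⟩
        scale R h s (linearExt (λ β → weight n σ′ Φ′ ((α +E δ) +E β)) M)
          ≈⟨ scale-congʳ s (linearExt-det-monomial n σ′ (λ r s eq → Finₚ.suc-injective (σ-inj _ _ eq)) μ′ Φ′ Φ′-ind (α +E δ)) ⟩
        scale R h s (Φ′ (α +E δ) * det R h n (λ r c → f (σ′ r) ((α +E δ) (σ′ r) ℤ.+ μ′ r c)))
          ≈⟨ scale-congʳ s (*-cong (*-cong Φ-unshifted f₀-shifted) (det-cong n minor-unshifted)) ⟩
        scale R h s ((Φ α * f (σ Fin.zero) (α (σ Fin.zero) ℤ.+ μ Fin.zero j)) * det R h n (λ r c → f (σ′ r) (α (σ′ r) ℤ.+ μ′ r c)))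
          ≈⟨ trans (scale-congʳ s (*-assoc _ _ _)) (scale-*-comm s _ _) ⟩
        Φ α * scale R h s (f (σ Fin.zero) (α (σ Fin.zero) ℤ.+ μ Fin.zero j) * det R h n (λ r c → f (σ′ r) (α (σ′ r) ℤ.+ μ′ r c))) ∎
        where
        s = sign R h (toℕ j)
        δ = μ Fin.zero j *E unitE (σ Fin.zero)
        μ′ : Fin n → Fin n → ℤ
        μ′ r c = μ (Fin.suc r) (punchIn j c)
        M = det LaurentRing noH n (monomialMatrix n σ′ μ′)
        W = λ β → weight (suc n) σ Φ (α +E β)
        shift : ∀ β → W (δ +E β) ≈ weight n σ′ Φ′ ((α +E δ) +E β)
        shift β = trans (weight-extensional (suc n) σ Φ-ind _ _ (λ k → ≡.sym (ℤₚ.+-assoc (α k) (δ k) (β k))))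
                        (weight-suc n σ Φ _)
        Φ-unshifted : Φ (α +E δ) ≈ Φ α
        Φ-unshifted = Φ-ind _ _ (λ k k∉σ → +E-*E-unitE-other α (μ Fin.zero j) (σ Fin.zero) k (k∉σ Fin.zero ∘ ≡.sym))
        f₀-shifted : f (σ Fin.zero) ((α +E δ) (σ Fin.zero)) ≈ f (σ Fin.zero) (α (σ Fin.zero) ℤ.+ μ Fin.zero j)
        f₀-shifted = reflexive (≡.cong (f (σ Fin.zero)) (+E-*E-unitE-same α (μ Fin.zero j) (σ Fin.zero)))
        minor-unshifted : ∀ r c → f (σ′ r) ((α +E δ) (σ′ r) ℤ.+ μ′ r c) ≈ f (σ′ r) (α (σ′ r) ℤ.+ μ′ r c)
        minor-unshifted r c = reflexive (≡.cong (λ w → f (σ′ r) (w ℤ.+ μ′ r c))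
          (+E-*E-unitE-other α (μ Fin.zero j) (σ Fin.zero) (σ′ r) (σ′≢σ₀ r)))

module RaisingOperators {a b} (R : CommutativeRing a b) (h : ℕ → CommutativeRing.Carrier R) (ℓ : ℕ) where
  open CommutativeRing R
  open Determinant R h using (det-cong)
  open LaurentPolynomials R h ℓ
  open MonomialDeterminant R h ℓ
  open Determinant LaurentRing noH using () renaming (_^_ to _^ᴸ_; det-cong to detᴸ-cong; det-vandermonde-inverse to detᴸ-vandermonde-inverse)
  open SetoidReasoning setoid

  monomial-cong : ∀ {α β : Exp ℓ} → (∀ k → α k ≡ β k) → monomial α ≃ monomial β
  monomial-cong {α} {β} α≡β = mk≃ λ F F-ext →
    trans (linearExt-monomial F α) (trans (F-ext _ _ α≡β) (sym (linearExt-monomial F β)))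

  monomial-^ : ∀ (e : Exp ℓ) k → monomial e ^ᴸ k ≃ monomial ((+ k) *E e)
  monomial-^ e zero    = monomial-cong (λ i → ≡.sym (ℤₚ.*-zeroˡ (e i)))
  monomial-^ e (suc k) = ≃-trans (⊗-cong (≃-refl {monomial e}) (monomial-^ e k))
    (monomial-cong (λ i → ≡.trans (≡.cong (λ w → w ℤ.+ (+ k ℤ.* e i)) (≡.sym (ℤₚ.*-identityˡ (e i))))
                                  (≡.sym (ℤₚ.*-distribʳ-+ (e i) (+ 1) (+ k)))))

  -- exponent shifts of g_γ = det (k^{(i)}_{γ_i + j - i}) relative to k_γ
  shifts : Fin ℓ → Fin ℓ → ℤ
  shifts r c = + toℕ c ℤ.- + toℕ r

  z z⁻¹ : Fin ℓ → LP ℓ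
  z r   = monomial (unitE r)
  z⁻¹ r = monomial ((ℤ.- (+ 1)) *E unitE r)

  z*z⁻¹≃1 : ∀ r → (z r ⊗ z⁻¹ r) ≃ oneLP
  z*z⁻¹≃1 r = monomial-cong (λ k → ≡.trans (≡.cong (λ w → unitE r k ℤ.+ w) (ℤₚ.-1*i≡-i (unitE r k))) (ℤₚ.+-inverseʳ (unitE r k)))

  shift-monomial : ∀ r c → monomial (shifts r c *E unitE r) ≃ ((z r ^ᴸ toℕ c) ⊗ (z⁻¹ r ^ᴸ toℕ r))
  shift-monomial r c = ≃-sym (≃-trans (⊗-cong (monomial-^ (unitE r) (toℕ c)) (monomial-^ _ (toℕ r)))
    (monomial-cong (λ k → exponent (+ toℕ c) (+ toℕ r) (unitE r k))))
    where
    open import Data.Integer.Solver using (module +-*-Solver)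
    open +-*-Solver using (solve; _:+_; _:*_; _:-_; :-_; _:=_; con)
    exponent : ∀ c′ r′ u → c′ ℤ.* u ℤ.+ r′ ℤ.* ((ℤ.- (+ 1)) ℤ.* u) ≡ (c′ ℤ.- r′) ℤ.* u
    exponent = solve 3 (λ c′ r′ u → c′ :* u :+ r′ :* (:- con (+ 1) :* u) := (c′ :- r′) :* u) ≡.refl

  vandermonde : LP ℓ
  vandermonde = prodLP (map (λ (i , j) → oneMinusR i j) (posRoots ℓ))

  det-shifts≃vandermonde : det LaurentRing noH ℓ (monomialMatrix ℓ (λ r → r) shifts) ≃ vandermonde
  det-shifts≃vandermonde = ≃-trans (detᴸ-cong ℓ shift-monomial) (detᴸ-vandermonde-inverse ℓ z z⁻¹ z*z⁻¹≃1)

  kγ-extensional : Extensional (kγ R h ℓ)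
  kγ-extensional α β α≡β = BigOperators.∏-cong R h (allFin ℓ) (λ i → reflexive (≡.cong (kr R h (+ toℕ i)) (α≡β i)))

  gγ≈linearExt-vandermonde : ∀ γ → gγ R h ℓ γ ≈ linearExt (λ β → kγ R h ℓ (γ +E β)) vandermonde
  gγ≈linearExt-vandermonde γ = begin
    gγ R h ℓ γ
      ≈⟨ det-cong ℓ (λ i j → reflexive (≡.cong (kr R h (+ toℕ i)) (ℤₚ.+-assoc (γ i) (+ toℕ j) (ℤ.- (+ toℕ i))))) ⟩
    det R h ℓ (λ r c → kr R h (+ toℕ r) (γ r ℤ.+ shifts r c))
      ≈⟨ *-identityˡ _ ⟨
    1# * det R h ℓ (λ r c → kr R h (+ toℕ r) (γ r ℤ.+ shifts r c))
      ≈⟨ linearExt-det-monomial (λ i → kr R h (+ toℕ i)) ℓ (λ r → r) (λ _ _ r≡s → r≡s) shifts (λ _ → 1#) (λ _ _ _ → refl) γ ⟨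
    linearExt (λ β → 1# * kγ R h ℓ (γ +E β)) (det LaurentRing noH ℓ (monomialMatrix ℓ (λ r → r) shifts))
      ≈⟨ linearExt-congˡ (det LaurentRing noH ℓ (monomialMatrix ℓ (λ r → r) shifts)) (λ β → *-identityˡ _) ⟩
    linearExt (λ β → kγ R h ℓ (γ +E β)) (det LaurentRing noH ℓ (monomialMatrix ℓ (λ r → r) shifts))
      ≈⟨ linearExt-≈ det-shifts≃vandermonde _ (shift-extensional kγ-extensional γ) ⟩
    linearExt (λ β → kγ R h ℓ (γ +E β)) vandermonde ∎

  κ≈linearExt : ∀ q → κ R h q ≈ linearExt (kγ R h ℓ) q
  κ≈linearExt []            = refl
  κ≈linearExt ((c , α) ∷ q) = +-congˡ (κ≈linearExt q)

  gmap≈κ-vandermonde : ∀ q → gmap R h q ≈ κ R h (q ⊗ vandermonde)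
  gmap≈κ-vandermonde q = begin
    gmap R h q                                                  ≈⟨ gmap≈linearExt q ⟩
    linearExt (gγ R h ℓ) q                                      ≈⟨ linearExt-congˡ q gγ≈linearExt-vandermonde ⟩
    linearExt (λ α → linearExt (λ β → kγ R h ℓ (α +E β)) vandermonde) q  ≈⟨ linearExt-⊗ q vandermonde (kγ R h ℓ) ⟨
    linearExt (kγ R h ℓ) (q ⊗ vandermonde)                      ≈⟨ κ≈linearExt (q ⊗ vandermonde) ⟨
    κ R h (q ⊗ vandermonde)                                     ∎
    where
    gmap≈linearExt : ∀ q → gmap R h q ≈ linearExt (gγ R h ℓ) q
    gmap≈linearExt []            = refl
    gmap≈linearExt ((c , α) ∷ q) = +-congˡ (gmap≈linearExt q)

i≤+∣i∣ : ∀ i → i ℤ.≤ + ∣ i ∣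
i≤+∣i∣ (+ n)    = ℤₚ.≤-refl
i≤+∣i∣ -[1+ n ] = ℤ.-≤+

∑ℤ : ∀ {A : Set} → List A → (A → ℤ) → ℤ
∑ℤ = BigOperators.∑ ℤₚ.+-*-commutativeRing (λ _ → + 0)

∑ℤ-mono-≤ : ∀ {A : Set} (xs : List A) f g → (∀ x → f x ℤ.≤ g x) → ∑ℤ xs f ℤ.≤ ∑ℤ xs g
∑ℤ-mono-≤ []       f g f≤g = ℤₚ.≤-refl
∑ℤ-mono-≤ (x ∷ xs) f g f≤g = ℤₚ.+-mono-≤ (f≤g x) (∑ℤ-mono-≤ xs f g f≤g)

∑ℤ-negative : ∀ {A : Set} (xs : List A) g → ∑ℤ xs g ℤ.< + 0 → Any (λ x → g x ℤ.< + 0) xs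
∑ℤ-negative []       g (ℤ.+<+ ())
∑ℤ-negative (x ∷ xs) g ∑<0 with g x ℤₚ.<? + 0
... | yes gx<0 = here gx<0
... | no  gx≮0 = there (∑ℤ-negative xs g (ℤₚ.≤-<-trans rest≤∑ ∑<0))
  where
  rest≤∑ : ∑ℤ xs g ℤ.≤ g x ℤ.+ ∑ℤ xs g
  rest≤∑ = ≡.subst (ℤ._≤ g x ℤ.+ ∑ℤ xs g) (ℤₚ.+-identityˡ _) (ℤₚ.+-monoˡ-≤ (∑ℤ xs g) (ℤₚ.≮⇒≥ gx≮0))

m<n⇒m⊖n<0 : ∀ m n → m ℕ.< n → m ⊖ n ℤ.< + 0
m<n⇒m⊖n<0 zero    (suc n) _         rewrite ℤₚ.⊖-< {0} {suc n} (ℕ.s≤s ℕ.z≤n) = ℤ.-<+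
m<n⇒m⊖n<0 (suc m) (suc n) (ℕ.s≤s m<n) rewrite ℤₚ.[1+m]⊖[1+n]≡m⊖n m n = m<n⇒m⊖n<0 m n m<n

indicator : ∀ {p} {P : Set p} → Dec P → ℤ
indicator P? = if ⌊ P? ⌋ then + 1 else + 0

indicator-*-≤-∣∣ : ∀ {p} {P : Set p} (P? : Dec P) x → indicator P? ℤ.* x ℤ.≤ + ∣ x ∣
indicator-*-≤-∣∣ (yes _) x = ≡.subst (ℤ._≤ + ∣ x ∣) (≡.sym (ℤₚ.*-identityˡ x)) (i≤+∣i∣ x)
indicator-*-≤-∣∣ (no _)  x = ℤ.+≤+ ℕ.z≤n

indicator-*-negative : ∀ {p} {P : Set p} (P? : Dec P) x → indicator P? ℤ.* x ℤ.< + 0 → x ℤ.< + 0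
indicator-*-negative (yes _) x x<0 = ≡.subst (ℤ._< + 0) (ℤₚ.*-identityˡ x) x<0
indicator-*-negative (no _)  x (ℤ.+<+ ())

indicator-difference≤0 : ∀ {p q} {P : Set p} {Q : Set q} (P? : Dec P) (Q? : Dec Q) → (P → Q) →
  indicator P? ℤ.+ (ℤ.- (+ 1)) ℤ.* indicator Q? ℤ.≤ + 0
indicator-difference≤0 (yes _) (yes _) _   = ℤₚ.≤-refl
indicator-difference≤0 (yes p) (no ¬q) p⇒q = ⊥-elim (¬q (p⇒q p))
indicator-difference≤0 (no _)  (yes _) _   = ℤ.-≤+
indicator-difference≤0 (no _)  (no _)  _   = ℤₚ.≤-refl

module Tails (ℓ : ℕ) where
  open BigOperators ℤₚ.+-*-commutativeRing (λ _ → + 0) using (∑-cong; ∑-distrib-+; ∑-*ˡ; ∑-zero; sumFin-single)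

  tailSum : Exp ℓ → Fin ℓ → ℤ
  tailSum α t = ∑ℤ (allFin ℓ) (λ k → indicator (t Finₚ.≤? k) ℤ.* α k)

  tailSum-+E : ∀ α β t → tailSum (α +E β) t ≡ tailSum α t ℤ.+ tailSum β t
  tailSum-+E α β t = ≡.trans (∑-cong (allFin ℓ) (λ k → ℤₚ.*-distribˡ-+ (indicator (t Finₚ.≤? k)) (α k) (β k)))
    (∑-distrib-+ (allFin ℓ) (λ k → indicator (t Finₚ.≤? k) ℤ.* α k) (λ k → indicator (t Finₚ.≤? k) ℤ.* β k))

  tailSum-*E : ∀ c α t → tailSum (c *E α) t ≡ c ℤ.* tailSum α t
  tailSum-*E c α t = ≡.trans (∑-cong (allFin ℓ) (λ k → x*[c*y]≡c*[x*y] (indicator (t Finₚ.≤? k)) (α k)))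
    (∑-*ˡ (allFin ℓ) c (λ k → indicator (t Finₚ.≤? k) ℤ.* α k))
    where
    x*[c*y]≡c*[x*y] : ∀ x y → x ℤ.* (c ℤ.* y) ≡ c ℤ.* (x ℤ.* y)
    x*[c*y]≡c*[x*y] x y = ≡.trans (≡.sym (ℤₚ.*-assoc x c y)) (≡.trans (≡.cong (ℤ._* y) (ℤₚ.*-comm x c)) (ℤₚ.*-assoc c x y))

  tailSum-zeroE : ∀ t → tailSum zeroE t ≡ + 0
  tailSum-zeroE t = ∑-zero (allFin ℓ) _ (λ k → ℤₚ.*-zeroʳ (indicator (t Finₚ.≤? k)))

  tailSum-unitE : ∀ i t → tailSum (unitE i) t ≡ indicator (t Finₚ.≤? i)
  tailSum-unitE i t = ≡.trans
    (sumFin-single ℓ (λ k → indicator (t Finₚ.≤? k) ℤ.* unitE i k) i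
      (λ k k≢i → ≡.trans (≡.cong (indicator (t Finₚ.≤? k) ℤ.*_) (unitE-other i k k≢i)) (ℤₚ.*-zeroʳ (indicator (t Finₚ.≤? k)))))
    (≡.trans (≡.cong (indicator (t Finₚ.≤? i) ℤ.*_) (unitE-same i)) (ℤₚ.*-identityʳ (indicator (t Finₚ.≤? i))))

  tailSum-rootE : ∀ i j t → tailSum (rootE i j) t ≡ indicator (t Finₚ.≤? i) ℤ.+ (ℤ.- (+ 1)) ℤ.* indicator (t Finₚ.≤? j)
  tailSum-rootE i j t = ≡.trans (tailSum-+E (unitE i) _ t)
    (≡.cong₂ ℤ._+_ (tailSum-unitE i t) (≡.trans (tailSum-*E (ℤ.- (+ 1)) (unitE j) t) (≡.cong ((ℤ.- (+ 1)) ℤ.*_) (tailSum-unitE j t))))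

  TailBounded : ℤ → Exp ℓ → Set
  TailBounded B α = ∀ t → tailSum α t ℤ.≤ B

  TailBounded-+E : ∀ {B C α β} → TailBounded B α → TailBounded C β → TailBounded (B ℤ.+ C) (α +E β)
  TailBounded-+E {B} {C} {α} {β} α≤B β≤C t = ≡.subst (ℤ._≤ B ℤ.+ C) (≡.sym (tailSum-+E α β t)) (ℤₚ.+-mono-≤ (α≤B t) (β≤C t))

  zeroE-tailBounded : TailBounded (+ 0) zeroE
  zeroE-tailBounded t = ℤₚ.≤-reflexive (tailSum-zeroE t)

  neg-unitE-tailBounded : ∀ j → TailBounded (+ 0) ((ℤ.- (+ 1)) *E unitE j)
  neg-unitE-tailBounded j t = ≡.subst (ℤ._≤ + 0) (≡.sym (≡.trans (tailSum-*E (ℤ.- (+ 1)) (unitE j) t) (≡.cong ((ℤ.- (+ 1)) ℤ.*_) (tailSum-unitE j t))))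
    (-1*indicator≤0 (t Finₚ.≤? j))
    where
    -1*indicator≤0 : ∀ {P : Set} (P? : Dec P) → (ℤ.- (+ 1)) ℤ.* indicator P? ℤ.≤ + 0
    -1*indicator≤0 (yes _) = ℤ.-≤+
    -1*indicator≤0 (no _)  = ℤₚ.≤-refl

  rootE-tailBounded : ∀ i j → i Fin.< j → TailBounded (+ 0) (rootE i j)
  rootE-tailBounded i j i<j t = ≡.subst (ℤ._≤ + 0) (≡.sym (tailSum-rootE i j t))
    (indicator-difference≤0 (t Finₚ.≤? i) (t Finₚ.≤? j) (λ t≤i → ℕₚ.≤-trans t≤i (ℕₚ.<⇒≤ i<j)))

  tailSum-rootE-at-j : ∀ i j → i Fin.< j → tailSum (rootE i j) j ≡ -[1+ 0 ]
  tailSum-rootE-at-j i j i<j rewrite tailSum-rootE i j j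
    | ⌊⌋-no (j Finₚ.≤? i) (ℕₚ.<⇒≱ i<j) | ⌊⌋-yes (j Finₚ.≤? j) ℕₚ.≤-refl = ≡.refl

  power-rootE-tailBounded : ∀ N i j → i Fin.< j → TailBounded (+ 0) ((+ suc N) *E rootE i j)
  power-rootE-tailBounded N i j i<j t = ≡.subst (ℤ._≤ + 0) (≡.sym (tailSum-*E (+ suc N) (rootE i j) t))
    (≡.subst (ℤ._≤_ ((+ suc N) ℤ.* tailSum (rootE i j) t)) (ℤₚ.*-zeroʳ (+ suc N))
      (ℤₚ.*-monoˡ-≤-nonNeg (+ suc N) (rootE-tailBounded i j i<j t)))

  tailSum-power-rootE-at-j : ∀ N i j → i Fin.< j → tailSum ((+ suc N) *E rootE i j) j ≡ -[1+ N ]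
  tailSum-power-rootE-at-j N i j i<j = ≡.trans (tailSum-*E (+ suc N) (rootE i j) j)
    (≡.trans (≡.cong ((+ suc N) ℤ.*_) (tailSum-rootE-at-j i j i<j)) (≡.cong -[1+_] (ℕₚ.*-identityʳ N)))

  tailBound : Exp ℓ → ℕ
  tailBound γ = ∣ ∑ℤ (allFin ℓ) (λ k → + ∣ γ k ∣) ∣

  tailBounded-tailBound : ∀ γ → TailBounded (+ tailBound γ) γ
  tailBounded-tailBound γ t = ℤₚ.≤-trans (∑ℤ-mono-≤ (allFin ℓ) _ _ (λ k → indicator-*-≤-∣∣ (t Finₚ.≤? k) (γ k))) (i≤+∣i∣ _)

  tailSum-negative : ∀ α t → tailSum α t ℤ.< + 0 → Any (λ k → α k ℤ.< + 0) (allFin ℓ)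
  tailSum-negative α t tail<0 = Any.map (λ {k} → indicator-*-negative (t Finₚ.≤? k) (α k)) (∑ℤ-negative (allFin ℓ) _ tail<0)

All-⊗ : ∀ {ℓ} {P Q T : Exp ℓ → Set} (p q : LP ℓ) → All (P ∘ proj₂) p → All (Q ∘ proj₂) q →
  (∀ {α β} → P α → Q β → T (α +E β)) → All (T ∘ proj₂) (p ⊗ q)
All-⊗ p q Pp Qq PQ⇒T = Allₚ.concat⁺ (Allₚ.map⁺ (All.map (λ Pα → Allₚ.map⁺ (All.map (λ Qβ → PQ⇒T Pα Qβ) Qq)) Pp))

concatMap⁺ : ∀ {A B : Set} {Q : A → Set} {P : B → Set} (g : A → List B) →
  (∀ {x} → Q x → All P (g x)) → ∀ {xs} → All Q xs → All P (concatMap g xs)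
concatMap⁺ g Q⇒Pg Qxs = Allₚ.concat⁺ (Allₚ.map⁺ (All.map Q⇒Pg Qxs))

posRoots-< : ∀ ℓ → All (λ (i , j) → i Fin.< j) (posRoots ℓ)
posRoots-< ℓ = concatMap⁺ _ (λ {i} _ → concatMap⁺ _ (λ {j} _ → singleton-< i j) all-indices) all-indices
  where
  all-indices = All.universal (λ _ → tt) (allFin ℓ)
  singleton-< : ∀ i j → All (λ (i , j) → i Fin.< j) (if ⌊ i Finₚ.<? j ⌋ then [ (i , j) ] else [])
  singleton-< i j with i Finₚ.<? j
  ... | yes i<j = i<j ∷ []
  ... | no  _   = []

oneMinusPower : ∀ {ℓ} → ℕ → Fin ℓ → Fin ℓ → LP ℓ
oneMinusPower N i j = (+ 1 , zeroE) ∷ (ℤ.- (+ 1) , (+ suc N) *E rootE i j) ∷ []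

powerFactors : ∀ {ℓ} → ℕ → RootIdeal ℓ → List (LP ℓ)
powerFactors {ℓ} N Ψ = concatMap (λ (i , j) → if RootIdeal.mem Ψ i j then [ oneMinusPower N i j ] else []) (posRoots ℓ)

module Katalan {a b} (R : CommutativeRing a b) (h : ℕ → CommutativeRing.Carrier R) (ℓ : ℕ) where
  open CommutativeRing R
  open IntegerScaling R h using (scale-congʳ; scale-0#; scale-1; scale--1; solve; _:=_; _:-_; _:+_)
  open BigOperators R h using (∏-zero)
  open LaurentPolynomials R h ℓ
  open MonomialDeterminant R h ℓ using (noH)
  open RaisingOperators R h ℓ
  open Tails ℓ
  open BigOperators LaurentRing noH using () renaming (∏-cong to ∏ᴸ-cong; ∏-distrib-* to ∏ᴸ-distrib-*;
    product-++ to productᴸ-++; product-concatMap to productᴸ-concatMap)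
  open IntegerScaling LaurentRing noH using () renaming (solve to solveᴸ; _:=_ to _:=ᴸ_; _:*_ to _:*ᴸ_)
  open SetoidReasoning setoid

  geomTrunc⊗oneMinusR : ∀ N i j → (geomTrunc N i j ⊗ oneMinusR i j) ≃ oneMinusPower N i j
  geomTrunc⊗oneMinusR N i j = mk≃ λ F F-ext → begin
    linearExt F (geomTrunc N i j ⊗ oneMinusR i j)
      ≈⟨ linearExt-⊗ (geomTrunc N i j) (oneMinusR i j) F ⟩
    linearExt (λ α → linearExt (λ β → F (α +E β)) (oneMinusR i j)) (geomTrunc N i j)
      ≈⟨ linearExt-congˡ (geomTrunc N i j) (difference F F-ext) ⟩
    linearExt (λ α → F α - F (α +E ρ)) (geomTrunc N i j)
      ≈⟨ telescope F F-ext N ⟩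
    F zeroE - F ((+ suc N) *E ρ)
      ≈⟨ +-cong (scale-1 _) (trans (+-identityʳ _) (scale--1 _)) ⟨
    linearExt F (oneMinusPower N i j) ∎
    where
    ρ = rootE i j
    difference : ∀ F → Extensional F → ∀ α → linearExt (λ β → F (α +E β)) (oneMinusR i j) ≈ F α - F (α +E ρ)
    difference F F-ext α = +-cong (trans (scale-1 _) (F-ext _ _ (λ k → ℤₚ.+-identityʳ (α k)))) (trans (+-identityʳ _) (scale--1 _))
    multiple-+E : ∀ n k → (((+ n) *E ρ) +E ρ) k ≡ ((+ suc n) *E ρ) k
    multiple-+E n k = ≡.trans (ℤₚ.+-comm (+ n ℤ.* ρ k) (ρ k)) (≡.sym (ℤₚ.suc-* (+ n) (ρ k)))
    telescope : ∀ F → Extensional F → ∀ N → linearExt (λ α → F α - F (α +E ρ)) (geomTrunc N i j) ≈ F zeroE - F ((+ suc N) *E ρ)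
    telescope F F-ext zero = trans (+-identityʳ _) (trans (scale-1 _)
      (+-cong (F-ext _ _ (λ k → ℤₚ.*-zeroˡ (ρ k))) (-‿cong (F-ext _ _ (multiple-+E 0)))))
    telescope F F-ext (suc N) = begin
      linearExt D (geomTrunc (suc N) i j)
        ≡⟨ ≡.cong (λ xs → linearExt D (map term xs)) (Listₚ.upTo-∷ʳ (suc N)) ⟨
      linearExt D (map term (upTo (suc N) ++ [ suc N ]))
        ≡⟨ ≡.cong (linearExt D) (Listₚ.map-++ term (upTo (suc N)) [ suc N ]) ⟩
      linearExt D (geomTrunc N i j ++ [ term (suc N) ])
        ≈⟨ linearExt-++ (geomTrunc N i j) [ term (suc N) ] D ⟩
      linearExt D (geomTrunc N i j) + linearExt D [ term (suc N) ]
        ≈⟨ +-cong (telescope F F-ext N) (trans (+-identityʳ _) (scale-1 _)) ⟩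
      (F zeroE - F ((+ suc N) *E ρ)) + (F ((+ suc N) *E ρ) - F (((+ suc N) *E ρ) +E ρ))
        ≈⟨ solve 3 (λ x y z → (x :- y) :+ (y :- z) := x :- z) refl _ _ _ ⟩
      F zeroE - F (((+ suc N) *E ρ) +E ρ)
        ≈⟨ +-congˡ (-‿cong (F-ext _ _ (multiple-+E (suc N)))) ⟩
      F zeroE - F ((+ suc (suc N)) *E ρ) ∎
      where
      D = λ α → F α - F (α +E ρ)
      term = λ n → (+ 1 , (+ n) *E ρ)

  geomTrunc-or-complement : ∀ N (b : Bool) i j →
    (prodLP (if b then [ geomTrunc N i j ] else []) ⊗ oneMinusR i j) ≃
    (prodLP (if b then [] else [ oneMinusR i j ]) ⊗ prodLP (if b then [ oneMinusPower N i j ] else []))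
  geomTrunc-or-complement N true  i j = ≃-trans (⊗-cong (⊗-identityʳ (geomTrunc N i j)) (≃-refl {oneMinusR i j}))
    (≃-trans (geomTrunc⊗oneMinusR N i j) (≃-sym (≃-trans (⊗-identityˡ _) (⊗-identityʳ (oneMinusPower N i j)))))
  geomTrunc-or-complement N false i j = ≃-trans (⊗-identityˡ (oneMinusR i j))
    (≃-sym (≃-trans (⊗-identityʳ _) (⊗-identityʳ (oneMinusR i j))))

  kr-negative : ∀ r z → z ℤ.< + 0 → kr R h r z ≈ 0#
  kr-negative r -[1+ n ] _         = refl
  kr-negative r (+ n)    (ℤ.+<+ ())

  -- some α_k is then negative, and k^{(r)}_m = 0 for m < 0
  kγ-vanishes : ∀ α t → tailSum α t ℤ.< + 0 → kγ R h ℓ α ≈ 0#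
  kγ-vanishes α t tail<0 =
    ∏-zero (allFin ℓ) _ (Any.map (λ {k} → kr-negative (+ toℕ k) (α k)) (tailSum-negative α t tail<0))

  κ-oneMinusPower-⊗ : ∀ {N₀} N i j → N₀ ℕ.≤ N → i Fin.< j → ∀ Q → All (TailBounded (+ N₀) ∘ proj₂) Q →
    linearExt (kγ R h ℓ) (oneMinusPower N i j ⊗ Q) ≈ linearExt (kγ R h ℓ) Q
  κ-oneMinusPower-⊗ {N₀} N i j N₀≤N i<j Q Q-bounded = begin
    linearExt (kγ R h ℓ) (oneMinusPower N i j ⊗ Q)
      ≈⟨ linearExt-⊗ (oneMinusPower N i j) Q (kγ R h ℓ) ⟩
    scale R h (+ 1) (linearExt (λ β → kγ R h ℓ (zeroE +E β)) Q) + (scale R h (ℤ.- (+ 1)) (linearExt (λ β → kγ R h ℓ (ρ +E β)) Q) + 0#)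
      ≈⟨ +-cong (trans (scale-1 _) (linearExt-congˡ Q (λ β → kγ-extensional _ _ (λ k → ℤₚ.+-identityˡ (β k)))))
                (trans (+-identityʳ _) (trans (scale-congʳ (ℤ.- (+ 1)) shifted-vanishes) (scale-0# (ℤ.- (+ 1))))) ⟩
    linearExt (kγ R h ℓ) Q + 0#
      ≈⟨ +-identityʳ _ ⟩
    linearExt (kγ R h ℓ) Q ∎
    where
    ρ = (+ suc N) *E rootE i j
    tail<0 : ∀ β → TailBounded (+ N₀) β → tailSum (ρ +E β) j ℤ.< + 0
    tail<0 β β-bounded = ℤₚ.≤-<-trans
      (≡.subst (ℤ._≤ -[1+ N ] ℤ.+ + N₀) (≡.sym (≡.trans (tailSum-+E ρ β j) (≡.cong (ℤ._+ tailSum β j) (tailSum-power-rootE-at-j N i j i<j))))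
        (ℤₚ.+-monoʳ-≤ -[1+ N ] (β-bounded j)))
      (m<n⇒m⊖n<0 N₀ (suc N) (ℕ.s≤s N₀≤N))
    shifted-vanishes : linearExt (λ β → kγ R h ℓ (ρ +E β)) Q ≈ 0#
    shifted-vanishes = linearExt-vanishes _ Q Q-bounded (λ β β-bounded → kγ-vanishes (ρ +E β) j (tail<0 β β-bounded))

  PowerFactor : ℕ → LP ℓ → Set
  PowerFactor N e = Σ (Fin ℓ × Fin ℓ) λ (i , j) → i Fin.< j × e ≡ oneMinusPower N i j

  ZeroTailBounded : LP ℓ → Set
  ZeroTailBounded = All (TailBounded (+ 0) ∘ proj₂)

  PowerFactor-zeroTailBounded : ∀ {N e} → PowerFactor N e → ZeroTailBounded e
  PowerFactor-zeroTailBounded {N} ((i , j) , i<j , ≡.refl) = zeroE-tailBounded ∷ power-rootE-tailBounded N i j i<j ∷ []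

  product-tailBounded : ∀ {B} fs e → All ZeroTailBounded fs → All (TailBounded B ∘ proj₂) e →
    All (TailBounded B ∘ proj₂) (foldr _⊗_ e fs)
  product-tailBounded         []       e []             e-bounded = e-bounded
  product-tailBounded {B} (f ∷ fs) e (f-bounded ∷ fs-bounded) e-bounded =
    All-⊗ f (foldr _⊗_ e fs) f-bounded (product-tailBounded fs e fs-bounded e-bounded)
      (λ {α} {β} α-bounded β-bounded → ≡.subst (λ B′ → TailBounded B′ (α +E β)) (ℤₚ.+-identityˡ B) (TailBounded-+E α-bounded β-bounded))

  κ-powerFactors-⊗ : ∀ {N₀} N → N₀ ℕ.≤ N → ∀ es → All (PowerFactor N) es → ∀ W → All (TailBounded (+ N₀) ∘ proj₂) W →
    linearExt (kγ R h ℓ) (prodLP es ⊗ W) ≈ linearExt (kγ R h ℓ) W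
  κ-powerFactors-⊗ N N₀≤N []       []         W W-bounded = linearExt-≈ (⊗-identityˡ W) _ kγ-extensional
  κ-powerFactors-⊗ {N₀} N N₀≤N (e ∷ es) (e-power ∷ es-power) W W-bounded with e-power
  ... | (i , j) , i<j , ≡.refl = begin
    linearExt (kγ R h ℓ) ((oneMinusPower N i j ⊗ prodLP es) ⊗ W)
      ≈⟨ linearExt-≈ (⊗-assoc (oneMinusPower N i j) (prodLP es) W) _ kγ-extensional ⟩
    linearExt (kγ R h ℓ) (oneMinusPower N i j ⊗ (prodLP es ⊗ W))
      ≈⟨ κ-oneMinusPower-⊗ N i j N₀≤N i<j (prodLP es ⊗ W) rest-bounded ⟩
    linearExt (kγ R h ℓ) (prodLP es ⊗ W)
      ≈⟨ κ-powerFactors-⊗ N N₀≤N es es-power W W-bounded ⟩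
    linearExt (kγ R h ℓ) W ∎
    where
    rest-bounded : All (TailBounded (+ N₀) ∘ proj₂) (prodLP es ⊗ W)
    rest-bounded = All-⊗ (prodLP es) W
      (product-tailBounded es oneLP (All.map (PowerFactor-zeroTailBounded {N}) es-power) (zeroE-tailBounded ∷ []))
      W-bounded (λ {α} {β} α-bounded β-bounded → TailBounded-+E {α = α} {β} α-bounded β-bounded)

  module _ (Ψ : RootIdeal ℓ) where
    open RootIdeal Ψ using (mem)

    idealFactors⊗vandermonde : ∀ N →
      (prodLP (idealFactorsTrunc N Ψ) ⊗ vandermonde) ≃ (prodLP (complementFactors Ψ) ⊗ prodLP (powerFactors N Ψ))
    idealFactors⊗vandermonde N =
      ≃-trans (⊗-cong (productᴸ-concatMap (posRoots ℓ) _) (≃-refl {vandermonde}))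
      (≃-trans (≃-sym (∏ᴸ-distrib-* (posRoots ℓ) _ _))
      (≃-trans (∏ᴸ-cong (posRoots ℓ) (λ (i , j) → geomTrunc-or-complement N (mem i j) i j))
      (≃-trans (∏ᴸ-distrib-* (posRoots ℓ) _ _)
      (⊗-cong (≃-sym (productᴸ-concatMap (posRoots ℓ) _)) (≃-sym (productᴸ-concatMap (posRoots ℓ) _))))))

    powerFactors-PowerFactor : ∀ N → All (PowerFactor N) (powerFactors N Ψ)
    powerFactors-PowerFactor N = concatMap⁺ _ (λ {(i , j)} i<j → singleton (mem i j) i<j) (posRoots-< ℓ)
      where
      singleton : ∀ b {i j} → i Fin.< j → All (PowerFactor N) (if b then [ oneMinusPower N i j ] else [])
      singleton true  {i} {j} i<j = ((i , j) , i<j , ≡.refl) ∷ []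
      singleton false         _   = []

    module _ (m : Fin ℓ → ℕ) (γ : Exp ℓ) where

      rhsProduct : LP ℓ
      rhsProduct = prodLP (multisetFactors m ++ complementFactors Ψ ++ [ monomial γ ])

      rhsProduct-tailBounded : All (TailBounded (+ tailBound γ) ∘ proj₂) rhsProduct
      rhsProduct-tailBounded = ≡.subst (All (TailBounded (+ tailBound γ) ∘ proj₂)) (≡.sym product-split)
        (product-tailBounded (multisetFactors m) _ multiset-bounded
          (product-tailBounded (complementFactors Ψ) _ complement-bounded
            (All-⊗ {P = TailBounded (+ tailBound γ)} {Q = TailBounded (+ 0)} (monomial γ) oneLP
              (tailBounded-tailBound γ ∷ []) (zeroE-tailBounded ∷ [])
              (λ {α} {β} α-bounded β-bounded → ≡.subst (λ B → TailBounded B (α +E β)) (ℤₚ.+-identityʳ _)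
                                                 (TailBounded-+E {α = α} {β} α-bounded β-bounded)))))
        where
        product-split : rhsProduct ≡ foldr _⊗_ (foldr _⊗_ (monomial γ ⊗ oneLP) (complementFactors Ψ)) (multisetFactors m)
        product-split = ≡.trans (Listₚ.foldr-++ _⊗_ oneLP (multisetFactors m) _)
          (≡.cong (λ e → foldr _⊗_ e (multisetFactors m)) (Listₚ.foldr-++ _⊗_ oneLP (complementFactors Ψ) [ monomial γ ]))
        multiset-bounded : All ZeroTailBounded (multisetFactors m)
        multiset-bounded = concatMap⁺ _ (λ {j} _ → Allₚ.replicate⁺ (m j) (zeroE-tailBounded ∷ neg-unitE-tailBounded j ∷ []))
          (All.universal (λ _ → tt) (allFin ℓ))
        complement-factor : ∀ b {i j} → i Fin.< j → All ZeroTailBounded (if b then [] else [ oneMinusR i j ])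
        complement-factor true          _   = []
        complement-factor false {i} {j} i<j = (zeroE-tailBounded ∷ rootE-tailBounded i j i<j ∷ []) ∷ []
        complement-bounded : All ZeroTailBounded (complementFactors Ψ)
        complement-bounded = concatMap⁺ _ (λ {(i , j)} i<j → complement-factor (mem i j) i<j) (posRoots-< ℓ)

      truncated⊗vandermonde : ∀ N →
        (prodLP (idealFactorsTrunc N Ψ ++ multisetFactors m ++ [ monomial γ ]) ⊗ vandermonde) ≃ (prodLP (powerFactors N Ψ) ⊗ rhsProduct)
      truncated⊗vandermonde N =
        ≃-trans (⊗-cong (≃-trans (productᴸ-++ I (M ++ [ Z ])) (⊗-cong (≃-refl {prodLP I}) (productᴸ-++ M [ Z ]))) (≃-refl {vandermonde}))
        (≃-trans (solveᴸ 4 (λ i m z v → (i :*ᴸ (m :*ᴸ z)) :*ᴸ v :=ᴸ (i :*ᴸ v) :*ᴸ (m :*ᴸ z)) ≃-refl (prodLP I) (prodLP M) (prodLP [ Z ]) vandermonde)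
        (≃-trans (⊗-cong (idealFactors⊗vandermonde N) (≃-refl {prodLP M ⊗ prodLP [ Z ]}))
        (≃-trans (solveᴸ 4 (λ c e m z → (c :*ᴸ e) :*ᴸ (m :*ᴸ z) :=ᴸ e :*ᴸ (m :*ᴸ (c :*ᴸ z))) ≃-refl (prodLP C) (prodLP E) (prodLP M) (prodLP [ Z ]))
        (⊗-cong (≃-refl {prodLP E}) (≃-sym (≃-trans (productᴸ-++ M (C ++ [ Z ])) (⊗-cong (≃-refl {prodLP M}) (productᴸ-++ C [ Z ]))))))))
        where
        I = idealFactorsTrunc N Ψ
        M = multisetFactors m
        Z = monomial γ
        C = complementFactors Ψ
        E = powerFactors N Ψ

proposition2p2 : ∀ {a b} (R : CommutativeRing a b) (h : ℕ → CommutativeRing.Carrier R)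
                 (ℓ : ℕ) (Ψ : RootIdeal ℓ) (m : Fin ℓ → ℕ) (γ : Fin ℓ → ℤ) →
                 ∃ λ N₀ → ∀ N → N₀ ≤ N →
                   CommutativeRing._≈_ R (KatalanTrunc R h N Ψ m γ) (KatalanRHS R h Ψ m γ)
proposition2p2 R h ℓ Ψ m γ = Tails.tailBound ℓ γ , λ N N₀≤N → begin
  KatalanTrunc R h N Ψ m γ
    ≈⟨ gmap≈κ-vandermonde (truncated N) ⟩
  κ R h (truncated N ⊗ vandermonde)
    ≈⟨ κ≈linearExt (truncated N ⊗ vandermonde) ⟩
  linearExt (kγ R h ℓ) (truncated N ⊗ vandermonde)
    ≈⟨ linearExt-≈ (truncated⊗vandermonde Ψ m γ N) (kγ R h ℓ) kγ-extensional ⟩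
  linearExt (kγ R h ℓ) (prodLP (powerFactors N Ψ) ⊗ rhsProduct Ψ m γ)
    ≈⟨ κ-powerFactors-⊗ N N₀≤N _ (powerFactors-PowerFactor Ψ N) _ (rhsProduct-tailBounded Ψ m γ) ⟩
  linearExt (kγ R h ℓ) (rhsProduct Ψ m γ)
    ≈⟨ κ≈linearExt (rhsProduct Ψ m γ) ⟨
  KatalanRHS R h Ψ m γ ∎
  where
  open SetoidReasoning (CommutativeRing.setoid R)
  open LaurentPolynomials R h ℓ using (linearExt; linearExt-≈)
  open RaisingOperators R h ℓ using (vandermonde; gmap≈κ-vandermonde; κ≈linearExt; kγ-extensional)
  open Katalan R h ℓ using (truncated⊗vandermonde; κ-powerFactors-⊗; powerFactors-PowerFactor; rhsProduct; rhsProduct-tailBounded)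
  truncated : ℕ → LP ℓ
  truncated N = prodLP (idealFactorsTrunc N Ψ ++ multisetFactors m ++ [ monomial γ ])
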